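{- Let $n>0$ be an integer. Then \[ \sum_{0\le 3j\le n}\frac{(-1)^j(q^3;q^3)_{n-j-1}(1-q^{2n})\,q^{3j^2-3j}}{(q;q)_{n-3j}\,(q^6;q^6)_{j}} \;=\; \sum_{j=-\infty}^{\infty}(-1)^j q^{3j^2+3j}{2n\brack n-3j}_q . \]
   Context: For a non-negative integer $L$, $(a;q)_L=\prod_{k=0}^{L-1}(1-aq^k)$. For integers $m,n$, the $q$-binomial coefficient is ${m+n\brack n}_q=\frac{(q;q)_{m+n}}{(q;q)_m(q;q)_n}$ if $m,n\ge 0$ and $0$ otherwise. -}

module Defs where

open import Data.Nat as ℕ using (ℕ; zero; suc; _≤?_)
open import Data.Integer as ℤ using (ℤ; +_; -[1+_])
open import Data.Rational using (ℚ; 0ℚ; 1ℚ; _+_; _*_; _-_; -_; 1/_; ≢-nonZero)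
open import Data.Rational.Properties using (_≟_)
open import Relation.Nullary using (yes; no)

infixr 8 _^_
_^_ : ℚ → ℕ → ℚ
x ^ zero  = 1ℚ
x ^ suc k = x * (x ^ k)

-- total inverse (inv 0 = 0); only ever applied to nonzero denominators
inv : ℚ → ℚ
inv p with p ≟ 0ℚ
... | yes _ = 0ℚ
... | no p≢0 = 1/_ p {{≢-nonZero p≢0}}

infixl 7 _/_
_/_ : ℚ → ℚ → ℚ
x / y = x * inv y

sgn : ℕ → ℚ
sgn zero = 1ℚ
sgn (suc j) = - sgn j

poch : ℚ → ℚ → ℕ → ℚ
poch a q zero    = 1ℚ
poch a q (suc L) = poch a q L * (1ℚ - a * q ^ L)

-- q-binomial [m+n choose n]_q for integers m, n (0 unless m, n ≥ 0)
qbinomℤ : ℚ → ℤ → ℤ → ℚ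
qbinomℤ q (+ m) (+ k) = poch q q (m ℕ.+ k) / (poch q q m * poch q q k)
qbinomℤ q _ _ = 0ℚ

-- [N choose K]_q with N ∈ ℕ, K ∈ ℤ, i.e. [ (N-K)+K choose K ]_q
qbinom : ℚ → ℕ → ℤ → ℚ
qbinom q N K = qbinomℤ q (+ N ℤ.- K) K

sumTo : ℕ → (ℕ → ℚ) → ℚ
sumTo zero f = 0ℚ
sumTo (suc m) f = sumTo m f + f m

lhsTerm : ℚ → ℕ → ℕ → ℚ
lhsTerm q n j with 3 ℕ.* j ≤? n
... | no _ = 0ℚ
... | yes _ =
  (sgn j * poch (q ^ 3) (q ^ 3) (n ℕ.∸ j ℕ.∸ 1) * (1ℚ - q ^ (2 ℕ.* n))
         * q ^ (3 ℕ.* j ℕ.* j ℕ.∸ 3 ℕ.* j))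
  / (poch q q (n ℕ.∸ 3 ℕ.* j) * poch (q ^ 6) (q ^ 6) j)

lhs : ℚ → ℕ → ℚ
lhs q n = sumTo (suc n) (lhsTerm q n)

rhsTerm : ℚ → ℕ → ℤ → ℚ
rhsTerm q n j =
  sgn ℤ.∣ j ∣ * q ^ (3 ℕ.* ℤ.∣ j ℤ.* (j ℤ.+ ℤ.+ 1) ∣)
    * qbinom q (2 ℕ.* n) (+ n ℤ.- (ℤ.+ 3) ℤ.* j)

-- RHS: the bilateral sum; terms with |j| > n vanish (the q-binomial is 0),
-- so we sum over j = -n .. n, i.e. j = i - n for i = 0 .. 2n.
rhs : ℚ → ℕ → ℚ
rhs q n = sumTo (suc (2 ℕ.* n)) (λ i → rhsTerm q n (+ i ℤ.- + n))

-- For n ≥ 3 both sides satisfy the same monic linear recurrence of order four in n,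
--   Σᵢ₌₀⁴ cᵢ(q, qⁿ) S(n + i) = 0.
-- It is proved by creative telescoping: for each summand F(n, j) there is an explicit G(n, j) with
-- Σᵢ cᵢ F(n + i, j) = G(n, j + 1) − G(n, j), and G vanishes at both ends of the range of summation.
-- After dividing out a common hypergeometric factor, each of these relations is an identity between
-- Laurent polynomials in q, X = qⁿ and Z = q³ʲ, decided by a verified normaliser. The two sides agree
-- for n = 1, …, 6 (again by normalisation, once denominators are cleared), so they agree for all n ≥ 1.
-- The hypothesis qᵏ ≠ 1 keeps the q-factorials invertible; at q = 0 both sides are 1 for n ≤ 2 and 0 afterwards.

module Submission where

open import Defs
open import Data.Bool using (Bool; true; false; T; if_then_else_)
open import Data.Empty using (⊥-elim)
open import Data.Integer as ℤ using (ℤ; +_; -[1+_])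
import Data.Integer.Properties as ℤP
open import Data.Integer.Tactic.RingSolver using (solve-∀)
import Data.Sign as Sign
open import Data.List using (List; []; _∷_)
open import Data.Nat as ℕ using (ℕ; zero; suc; _≤_; _<_; z≤n; s≤s)
open import Data.Nat.Induction using (<-rec)
import Data.Nat.Properties as ℕP
import Data.Nat.Tactic.RingSolver as ℕ-Ring
open import Function.Nary.NonDependent using (congₙ)
open import Data.Rational using (ℚ; 0ℚ; 1ℚ; _+_; _*_; _-_; -_; ≢-nonZero)
open import Data.Rational.Properties
  using (_≟_; 1≢0; heytingCommutativeRing; *-inverseʳ; *-distribʳ-+; +-identityˡ; +-identityʳ; *-identityˡ; *-identityʳ; *-zeroˡ; *-zeroʳ; +-assoc; *-assoc; *-comm)
import Data.Rational.Solver as ℚSolver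
open import Algebra.Apartness.Properties.HeytingCommutativeRing heytingCommutativeRing using (x#0y#0→xy#0)
open import Data.Sum using (_⊎_; inj₁; inj₂)
open import Relation.Nullary using (Dec; yes; no; does)
open import Relation.Binary.PropositionalEquality
open ≡-Reasoning

open ℚSolver.+-*-Solver using (solve; _:+_; _:*_; _:-_; :-_; _:=_; con)

inv-inverseʳ : ∀ x → x ≢ 0ℚ → x * inv x ≡ 1ℚ
inv-inverseʳ x x≢0 with x ≟ 0ℚ
... | yes x≡0 = ⊥-elim (x≢0 x≡0)
... | no _    = *-inverseʳ x {{≢-nonZero x≢0}}

inv-unique : ∀ x y → x * y ≡ 1ℚ → inv x ≡ y
inv-unique x y xy≡1 = begin
  inv x              ≡⟨ sym (*-identityʳ (inv x)) ⟩
  inv x * 1ℚ         ≡⟨ cong (inv x *_) (sym xy≡1) ⟩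
  inv x * (x * y)    ≡⟨ solve 3 (λ x i y → i :* (x :* y) := (x :* i) :* y) refl x (inv x) y ⟩
  (x * inv x) * y    ≡⟨ cong (_* y) (inv-inverseʳ x x≢0) ⟩
  1ℚ * y             ≡⟨ *-identityˡ y ⟩
  y                  ∎
  where
  x≢0 : x ≢ 0ℚ
  x≢0 refl = 1≢0 (trans (sym xy≡1) (*-zeroˡ y))

inv-distrib-* : ∀ x y → inv (x * y) ≡ inv x * inv y
inv-distrib-* x y = by-cases x y (x ≟ 0ℚ) (y ≟ 0ℚ)
  where
  by-cases : ∀ x y → Dec (x ≡ 0ℚ) → Dec (y ≡ 0ℚ) → inv (x * y) ≡ inv x * inv y
  by-cases x y (yes refl) _          = trans (cong inv (*-zeroˡ y)) (sym (*-zeroˡ (inv y)))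
  by-cases x y (no _)     (yes refl) = trans (cong inv (*-zeroʳ x)) (sym (*-zeroʳ (inv x)))
  by-cases x y (no x≢0)   (no y≢0)   = inv-unique (x * y) (inv x * inv y) (begin
    x * y * (inv x * inv y)   ≡⟨ solve 4 (λ x y i j → x :* y :* (i :* j) := (x :* i) :* (y :* j)) refl x y (inv x) (inv y) ⟩
    x * inv x * (y * inv y)   ≡⟨ cong₂ _*_ (inv-inverseʳ x x≢0) (inv-inverseʳ y y≢0) ⟩
    1ℚ * 1ℚ                   ≡⟨ *-identityʳ 1ℚ ⟩
    1ℚ                        ∎)

inv[P]≡x*inv[P*x] : ∀ P x → x ≢ 0ℚ → inv P ≡ x * inv (P * x)
inv[P]≡x*inv[P*x] P x x≢0 = begin
  inv P                      ≡⟨ sym (*-identityʳ (inv P)) ⟩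
  inv P * 1ℚ                 ≡⟨ cong (inv P *_) (sym (inv-inverseʳ x x≢0)) ⟩
  inv P * (x * inv x)        ≡⟨ solve 3 (λ i x j → i :* (x :* j) := x :* (i :* j)) refl (inv P) x (inv x) ⟩
  x * (inv P * inv x)        ≡⟨ cong (x *_) (sym (inv-distrib-* P x)) ⟩
  x * inv (P * x)            ∎

*-cancelˡ-≢0 : ∀ {c x y} → c ≢ 0ℚ → c * x ≡ c * y → x ≡ y
*-cancelˡ-≢0 {c} {x} {y} c≢0 cx≡cy = begin
  x                  ≡⟨ sym (*-identityˡ x) ⟩
  1ℚ * x             ≡⟨ cong (_* x) (sym inv[c]*c≡1) ⟩
  inv c * c * x      ≡⟨ *-assoc (inv c) c x ⟩
  inv c * (c * x)    ≡⟨ cong (inv c *_) cx≡cy ⟩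
  inv c * (c * y)    ≡⟨ sym (*-assoc (inv c) c y) ⟩
  inv c * c * y      ≡⟨ cong (_* y) inv[c]*c≡1 ⟩
  1ℚ * y             ≡⟨ *-identityˡ y ⟩
  y                  ∎
  where
  inv[c]*c≡1 : inv c * c ≡ 1ℚ
  inv[c]*c≡1 = trans (*-comm (inv c) c) (inv-inverseʳ c c≢0)

1-x≢0 : ∀ {x} → x ≢ 1ℚ → 1ℚ - x ≢ 0ℚ
1-x≢0 {x} x≢1 1-x≡0 = x≢1 (begin
  x                 ≡⟨ solve 1 (λ x → x := con 1ℚ :- (con 1ℚ :- x)) refl x ⟩
  1ℚ - (1ℚ - x)     ≡⟨ cong (λ y → 1ℚ - y) 1-x≡0 ⟩
  1ℚ - 0ℚ           ≡⟨⟩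
  1ℚ                ∎)

x-y≡0⇒x≡y : ∀ {x y} → x - y ≡ 0ℚ → x ≡ y
x-y≡0⇒x≡y {x} {y} x-y≡0 = begin
  x                ≡⟨ solve 2 (λ x y → x := (x :- y) :+ y) refl x y ⟩
  (x - y) + y      ≡⟨ cong (_+ y) x-y≡0 ⟩
  0ℚ + y           ≡⟨ +-identityˡ y ⟩
  y                ∎

^-distribˡ-+-* : ∀ x m n → x ^ (m ℕ.+ n) ≡ x ^ m * x ^ n
^-distribˡ-+-* x zero    n = sym (*-identityˡ _)
^-distribˡ-+-* x (suc m) n = trans (cong (x *_) (^-distribˡ-+-* x m n)) (sym (*-assoc x (x ^ m) (x ^ n)))

^-*-assoc : ∀ x m n → (x ^ m) ^ n ≡ x ^ (m ℕ.* n)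
^-*-assoc x m zero    = cong (x ^_) (sym (ℕP.*-zeroʳ m))
^-*-assoc x m (suc n) = begin
  x ^ m * (x ^ m) ^ n    ≡⟨ cong (x ^ m *_) (^-*-assoc x m n) ⟩
  x ^ m * x ^ (m ℕ.* n)  ≡⟨ sym (^-distribˡ-+-* x m (m ℕ.* n)) ⟩
  x ^ (m ℕ.+ m ℕ.* n)    ≡⟨ cong (x ^_) (sym (ℕP.*-suc m n)) ⟩
  x ^ (m ℕ.* suc n)      ∎

^-≢0 : ∀ {x} n → x ≢ 0ℚ → x ^ n ≢ 0ℚ
^-≢0 zero    x≢0 = 1≢0
^-≢0 (suc n) x≢0 = x#0y#0→xy#0 x≢0 (^-≢0 n x≢0)

laurent : ℚ → ℚ → ℤ → ℚ
laurent x y (+ n)      = x ^ n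
laurent x y -[1+ n ]   = y ^ suc n

laurent-neg : ∀ x y i → laurent x y (ℤ.- i) ≡ laurent y x i
laurent-neg x y (+ zero)  = refl
laurent-neg x y (+ suc n) = refl
laurent-neg x y -[1+ n ]  = refl

module _ {x y : ℚ} (xy≡1 : x * y ≡ 1ℚ) where

  laurent-⊖ : ∀ m n → laurent x y (m ℤ.⊖ n) ≡ x ^ m * y ^ n
  laurent-⊖ m       zero    = sym (*-identityʳ _)
  laurent-⊖ zero    (suc n) = sym (*-identityˡ _)
  laurent-⊖ (suc m) (suc n) = begin
    laurent x y (suc m ℤ.⊖ suc n)  ≡⟨ cong (laurent x y) (ℤP.[1+m]⊖[1+n]≡m⊖n m n) ⟩
    laurent x y (m ℤ.⊖ n)          ≡⟨ laurent-⊖ m n ⟩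
    x ^ m * y ^ n                  ≡⟨ sym (*-identityˡ _) ⟩
    1ℚ * (x ^ m * y ^ n)           ≡⟨ cong (_* (x ^ m * y ^ n)) (sym xy≡1) ⟩
    x * y * (x ^ m * y ^ n)        ≡⟨ solve 4 (λ a b c d → (a :* b) :* (c :* d) := (a :* c) :* (b :* d)) refl x y (x ^ m) (y ^ n) ⟩
    x ^ suc m * y ^ suc n          ∎

  laurent-distrib-+ : ∀ i j → laurent x y (i ℤ.+ j) ≡ laurent x y i * laurent x y j
  laurent-distrib-+ (+ m)    (+ n)    = ^-distribˡ-+-* x m n
  laurent-distrib-+ (+ m)    -[1+ n ] = laurent-⊖ m (suc n)
  laurent-distrib-+ -[1+ m ] (+ n)    = trans (laurent-⊖ n (suc m)) (*-comm (x ^ n) _)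
  laurent-distrib-+ -[1+ m ] -[1+ n ] = begin
    y * (y * y ^ (m ℕ.+ n))        ≡⟨ cong (λ z → y * (y * z)) (^-distribˡ-+-* y m n) ⟩
    y * (y * (y ^ m * y ^ n))      ≡⟨ solve 3 (λ a b c → a :* (a :* (b :* c)) := (a :* b) :* (a :* c)) refl y (y ^ m) (y ^ n) ⟩
    y ^ suc m * y ^ suc n          ∎

  laurent-inverse : ∀ i → laurent x y i * laurent y x i ≡ 1ℚ
  laurent-inverse i = begin
    laurent x y i * laurent y x i         ≡⟨ cong (laurent x y i *_) (sym (laurent-neg x y i)) ⟩
    laurent x y i * laurent x y (ℤ.- i)   ≡⟨ sym (laurent-distrib-+ i (ℤ.- i)) ⟩
    laurent x y (i ℤ.+ ℤ.- i)             ≡⟨ cong (laurent x y) (ℤP.+-inverseʳ i) ⟩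
    1ℚ                                    ∎

poch-+ : ∀ a b N d → poch a b (N ℕ.+ d) ≡ poch a b N * poch (a * b ^ N) b d
poch-+ a b N zero    = trans (cong (poch a b) (ℕP.+-identityʳ N)) (sym (*-identityʳ _))
poch-+ a b N (suc d) = begin
  poch a b (N ℕ.+ suc d)                                  ≡⟨ cong (poch a b) (ℕP.+-suc N d) ⟩
  poch a b (N ℕ.+ d) * (1ℚ - a * b ^ (N ℕ.+ d))           ≡⟨ cong₂ (λ P e → P * (1ℚ - a * e)) (poch-+ a b N d) (^-distribˡ-+-* b N d) ⟩
  poch a b N * poch (a * b ^ N) b d * (1ℚ - a * (b ^ N * b ^ d))
    ≡⟨ solve 5 (λ P R a u v → P :* R :* (con 1ℚ :- a :* (u :* v)) := P :* (R :* (con 1ℚ :- a :* u :* v))) refl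
         (poch a b N) (poch (a * b ^ N) b d) a (b ^ N) (b ^ d) ⟩
  poch a b N * poch (a * b ^ N) b (suc d)                 ∎

poch-+-inv : ∀ a b N d → poch a b N ≢ 0ℚ → poch a b (N ℕ.+ d) * inv (poch a b N) ≡ poch (a * b ^ N) b d
poch-+-inv a b N d P≢0 = begin
  poch a b (N ℕ.+ d) * inv P          ≡⟨ cong (_* inv P) (poch-+ a b N d) ⟩
  P * poch (a * b ^ N) b d * inv P    ≡⟨ solve 3 (λ P R i → P :* R :* i := (P :* i) :* R) refl P _ (inv P) ⟩
  (P * inv P) * poch (a * b ^ N) b d  ≡⟨ cong (_* poch (a * b ^ N) b d) (inv-inverseʳ P P≢0) ⟩
  1ℚ * poch (a * b ^ N) b d           ≡⟨ *-identityˡ _ ⟩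
  poch (a * b ^ N) b d                ∎
  where P = poch a b N

poch-≢0 : ∀ a b L → (∀ k → k < L → 1ℚ - a * b ^ k ≢ 0ℚ) → poch a b L ≢ 0ℚ
poch-≢0 a b zero    factors≢0 = 1≢0
poch-≢0 a b (suc L) factors≢0 = x#0y#0→xy#0 (poch-≢0 a b L (λ k k<L → factors≢0 k (ℕP.m<n⇒m<1+n k<L))) (factors≢0 L ℕP.≤-refl)

m-3j≡m⊖3j : ∀ m j → + m ℤ.- + 3 ℤ.* + j ≡ m ℤ.⊖ (3 ℕ.* j)
m-3j≡m⊖3j m j = trans (cong (λ a → + m ℤ.- a) (sym (ℤP.pos-* 3 j))) (ℤP.m-n≡m⊖n m (3 ℕ.* j))

3[1+m]²∸3[1+m]≡3[1+m]m : ∀ m → 3 ℕ.* suc m ℕ.* suc m ℕ.∸ 3 ℕ.* suc m ≡ 3 ℕ.* suc m ℕ.* m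
3[1+m]²∸3[1+m]≡3[1+m]m m = trans (cong (ℕ._∸ 3 ℕ.* suc m) (ℕP.*-suc (3 ℕ.* suc m) m)) (ℕP.m+n∸m≡n (3 ℕ.* suc m) (3 ℕ.* suc m ℕ.* m))

+∣j[j+1]∣≡j[j+1] : ∀ j → + ℤ.∣ j ℤ.* (j ℤ.+ + 1) ∣ ≡ j ℤ.* (j ℤ.+ + 1)
+∣j[j+1]∣≡j[j+1] (+ k)        = trans (cong +_ (ℤP.abs-◃ Sign.+ (k ℕ.* (k ℕ.+ 1)))) (sym (ℤP.+◃n≡+n (k ℕ.* (k ℕ.+ 1))))
+∣j[j+1]∣≡j[j+1] -[1+ zero ]  = refl
+∣j[j+1]∣≡j[j+1] -[1+ suc k ] = trans (cong +_ (ℤP.abs-◃ Sign.+ (suc (suc k) ℕ.* suc k))) (sym (ℤP.+◃n≡+n (suc (suc k) ℕ.* suc k)))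

-- Finite sums, telescoping and linear recurrences

sumTo-cong : ∀ m {f g : ℕ → ℚ} → (∀ i → i < m → f i ≡ g i) → sumTo m f ≡ sumTo m g
sumTo-cong zero    f≗g = refl
sumTo-cong (suc m) f≗g = cong₂ _+_ (sumTo-cong m (λ i i<m → f≗g i (ℕP.m<n⇒m<1+n i<m))) (f≗g m ℕP.≤-refl)

sumTo-+ : ∀ m (f g : ℕ → ℚ) → sumTo m (λ i → f i + g i) ≡ sumTo m f + sumTo m g
sumTo-+ zero    f g = refl
sumTo-+ (suc m) f g = trans (cong (_+ (f m + g m)) (sumTo-+ m f g))
  (solve 4 (λ a b c d → (a :+ b) :+ (c :+ d) := (a :+ c) :+ (b :+ d)) refl (sumTo m f) (sumTo m g) (f m) (g m))

*-distribˡ-sumTo : ∀ m c (f : ℕ → ℚ) → c * sumTo m f ≡ sumTo m (λ i → c * f i)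
*-distribˡ-sumTo zero    c f = *-zeroʳ c
*-distribˡ-sumTo (suc m) c f = trans (solve 3 (λ c a b → c :* (a :+ b) := c :* a :+ c :* b) refl c (sumTo m f) (f m))
  (cong (_+ c * f m) (*-distribˡ-sumTo m c f))

sumTo-suc : ∀ m (f : ℕ → ℚ) → sumTo (suc m) f ≡ f 0 + sumTo m (λ i → f (suc i))
sumTo-suc zero    f = trans (+-identityˡ (f 0)) (sym (+-identityʳ (f 0)))
sumTo-suc (suc m) f = trans (cong (_+ f (suc m)) (sumTo-suc m f)) (+-assoc (f 0) _ (f (suc m)))

sumTo-swap : ∀ m k (f : ℕ → ℕ → ℚ) → sumTo m (λ i → sumTo k (f i)) ≡ sumTo k (λ j → sumTo m (λ i → f i j))
sumTo-swap zero    k f = sym (trans (sumTo-cong k (λ _ _ → refl)) (sumTo-zero k))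
  where
  sumTo-zero : ∀ k → sumTo k (λ _ → 0ℚ) ≡ 0ℚ
  sumTo-zero zero    = refl
  sumTo-zero (suc k) = trans (+-identityʳ _) (sumTo-zero k)
sumTo-swap (suc m) k f = begin
  sumTo m (λ i → sumTo k (f i)) + sumTo k (f m)               ≡⟨ cong (_+ sumTo k (f m)) (sumTo-swap m k f) ⟩
  sumTo k (λ j → sumTo m (λ i → f i j)) + sumTo k (f m)       ≡⟨ sym (sumTo-+ k _ (f m)) ⟩
  sumTo k (λ j → sumTo (suc m) (λ i → f i j))                 ∎

sumTo-telescope : ∀ m (h : ℕ → ℚ) → sumTo m (λ i → h (suc i) - h i) ≡ h m - h 0
sumTo-telescope zero    h = solve 1 (λ a → con 0ℚ := a :- a) refl (h 0)
sumTo-telescope (suc m) h = trans (cong (_+ (h (suc m) - h m)) (sumTo-telescope m h))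
  (solve 3 (λ a b c → (b :- c) :+ (a :- b) := a :- c) refl (h (suc m)) (h m) (h 0))

sumTo-vanishing-tail : ∀ {a b} (f : ℕ → ℚ) → a ≤ b → (∀ i → a ≤ i → f i ≡ 0ℚ) → sumTo b f ≡ sumTo a f
sumTo-vanishing-tail {a} {b} f a≤b tail≡0 = trans (cong (λ n → sumTo n f) (sym (ℕP.m+[n∸m]≡n a≤b))) (extend (b ℕ.∸ a))
  where
  extend : ∀ k → sumTo (a ℕ.+ k) f ≡ sumTo a f
  extend zero    = cong (λ n → sumTo n f) (ℕP.+-identityʳ a)
  extend (suc k) = begin
    sumTo (a ℕ.+ suc k) f              ≡⟨ cong (λ n → sumTo n f) (ℕP.+-suc a k) ⟩
    sumTo (a ℕ.+ k) f + f (a ℕ.+ k)    ≡⟨ cong₂ _+_ (extend k) (tail≡0 (a ℕ.+ k) (ℕP.m≤m+n a k)) ⟩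
    sumTo a f + 0ℚ                     ≡⟨ +-identityʳ _ ⟩
    sumTo a f                          ∎

window : (ℤ → ℚ) → ℕ → ℚ
window f M = sumTo (suc (2 ℕ.* M)) (λ i → f (+ i ℤ.- + M))

window-suc : ∀ f M → window f (suc M) ≡ f -[1+ M ] + window f M + f (+ suc M)
window-suc f M = begin
  sumTo (suc (2 ℕ.* suc M)) g                              ≡⟨ cong (λ k → sumTo (suc k) g) (ℕP.*-suc 2 M) ⟩
  sumTo (suc (suc (2 ℕ.* M))) g + g (suc (suc (2 ℕ.* M)))  ≡⟨ cong₂ _+_ (sumTo-suc (suc (2 ℕ.* M)) g) (cong f top) ⟩
  g 0 + sumTo (suc (2 ℕ.* M)) (λ i → g (suc i)) + f (+ suc M)
    ≡⟨ cong (λ s → g 0 + s + f (+ suc M)) (sumTo-cong (suc (2 ℕ.* M)) (λ i _ → cong f (shift i))) ⟩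
  f -[1+ M ] + window f M + f (+ suc M)                    ∎
  where
  g : ℕ → ℚ
  g i = f (+ i ℤ.- + suc M)
  shift : ∀ i → + suc i ℤ.- + suc M ≡ + i ℤ.- + M
  shift i = trans (ℤP.m-n≡m⊖n (suc i) (suc M)) (trans (ℤP.[1+m]⊖[1+n]≡m⊖n i M) (sym (ℤP.m-n≡m⊖n i M)))
  top : + suc (suc (2 ℕ.* M)) ℤ.- + suc M ≡ + suc M
  top = trans (shift (suc (2 ℕ.* M))) (1+2m-m≡1+m (+ M))
    where
    1+2m-m≡1+m : ∀ m → + 1 ℤ.+ (m ℤ.+ (m ℤ.+ + 0)) ℤ.- m ≡ + 1 ℤ.+ m
    1+2m-m≡1+m = solve-∀

window-vanishing : ∀ f {M M′} → M ≤ M′ → (∀ k → M < ℤ.∣ k ∣ → f k ≡ 0ℚ) → window f M′ ≡ window f M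
window-vanishing f {M} {M′} M≤M′ outside≡0 = trans (cong (window f) (sym (ℕP.m+[n∸m]≡n M≤M′))) (extend (M′ ℕ.∸ M))
  where
  extend : ∀ k → window f (M ℕ.+ k) ≡ window f M
  extend zero    = cong (window f) (ℕP.+-identityʳ M)
  extend (suc k) = begin
    window f (M ℕ.+ suc k)                                          ≡⟨ cong (window f) (ℕP.+-suc M k) ⟩
    window f (suc (M ℕ.+ k))                                        ≡⟨ window-suc f (M ℕ.+ k) ⟩
    f -[1+ M ℕ.+ k ] + window f (M ℕ.+ k) + f (+ suc (M ℕ.+ k))     ≡⟨ cong₂ (λ a b → a + window f (M ℕ.+ k) + b) (outside≡0 _ M<) (outside≡0 _ M<) ⟩
    0ℚ + window f (M ℕ.+ k) + 0ℚ                                    ≡⟨ solve 1 (λ w → con 0ℚ :+ w :+ con 0ℚ := w) refl _ ⟩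
    window f (M ℕ.+ k)                                              ≡⟨ extend k ⟩
    window f M                                                      ∎
    where
    M< : M < suc (M ℕ.+ k)
    M< = s≤s (ℕP.m≤m+n M k)

creative-telescoping : ∀ d K (c : ℕ → ℚ) (F : ℕ → ℕ → ℚ) (G : ℕ → ℚ) →
  (∀ j → j < K → sumTo d (λ i → c i * F i j) ≡ G (suc j) - G j) → G K ≡ 0ℚ → G 0 ≡ 0ℚ →
  sumTo d (λ i → c i * sumTo K (F i)) ≡ 0ℚ
creative-telescoping d K c F G certificate G[K]≡0 G[0]≡0 = begin
  sumTo d (λ i → c i * sumTo K (F i))              ≡⟨ sumTo-cong d (λ i _ → *-distribˡ-sumTo K (c i) (F i)) ⟩
  sumTo d (λ i → sumTo K (λ j → c i * F i j))      ≡⟨ sumTo-swap d K (λ i j → c i * F i j) ⟩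
  sumTo K (λ j → sumTo d (λ i → c i * F i j))      ≡⟨ sumTo-cong K certificate ⟩
  sumTo K (λ j → G (suc j) - G j)                  ≡⟨ sumTo-telescope K G ⟩
  G K - G 0                                        ≡⟨ cong₂ _-_ G[K]≡0 G[0]≡0 ⟩
  0ℚ - 0ℚ                                          ≡⟨⟩
  0ℚ                                               ∎

monic-recurrence-unique : ∀ d a (c : ℕ → ℕ → ℚ) {u v : ℕ → ℚ} → (∀ n → c d n ≡ 1ℚ) →
  (∀ n → a ≤ n → sumTo (suc d) (λ i → c i n * u (n ℕ.+ i)) ≡ 0ℚ) →
  (∀ n → a ≤ n → sumTo (suc d) (λ i → c i n * v (n ℕ.+ i)) ≡ 0ℚ) →
  (∀ n → a ≤ n → n < a ℕ.+ d → u n ≡ v n) →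
  ∀ n → a ≤ n → u n ≡ v n
monic-recurrence-unique d a c {u} {v} monic rec-u rec-v initial = <-rec _ step
  where
  lower : (ℕ → ℚ) → ℕ → ℚ
  lower w m = sumTo d (λ i → c i m * w (m ℕ.+ i))

  leading : ∀ w m → sumTo (suc d) (λ i → c i m * w (m ℕ.+ i)) ≡ lower w m + w (m ℕ.+ d)
  leading w m = trans (cong (λ e → lower w m + e * w (m ℕ.+ d)) (monic m)) (cong (λ x → lower w m + x) (*-identityˡ (w (m ℕ.+ d))))

  step : ∀ n → (∀ {m} → m < n → a ≤ m → u m ≡ v m) → a ≤ n → u n ≡ v n
  step n ih a≤n with n ℕ.<? a ℕ.+ d
  ... | yes n<a+d = initial n a≤n n<a+d
  ... | no  n≮a+d = subst (λ k → u k ≡ v k) m+d≡n (begin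
    u (m ℕ.+ d)                               ≡⟨ solve 2 (λ s x → x := (s :+ x) :- s) refl (lower u m) (u (m ℕ.+ d)) ⟩
    (lower u m + u (m ℕ.+ d)) - lower u m     ≡⟨ cong₂ _-_ (trans (sym (leading u m)) (rec-u m a≤m)) lower-u≡lower-v ⟩
    0ℚ - lower v m                            ≡⟨ cong (_- lower v m) (sym (trans (sym (leading v m)) (rec-v m a≤m))) ⟩
    (lower v m + v (m ℕ.+ d)) - lower v m     ≡⟨ solve 2 (λ s x → (s :+ x) :- s := x) refl (lower v m) (v (m ℕ.+ d)) ⟩
    v (m ℕ.+ d)                               ∎)
    where
    a+d≤n = ℕP.≮⇒≥ n≮a+d
    m = n ℕ.∸ d
    m+d≡n : m ℕ.+ d ≡ n
    m+d≡n = ℕP.m∸n+n≡m (ℕP.≤-trans (ℕP.m≤n+m d a) a+d≤n)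
    a≤m : a ≤ m
    a≤m = ℕP.≤-trans (ℕP.≤-reflexive (sym (ℕP.m+n∸n≡m a d))) (ℕP.∸-monoˡ-≤ d a+d≤n)
    lower-u≡lower-v : lower u m ≡ lower v m
    lower-u≡lower-v = sumTo-cong d (λ i i<d → cong (c i m *_)
      (ih (subst (m ℕ.+ i <_) m+d≡n (ℕP.+-monoʳ-< m i<d)) (ℕP.≤-trans a≤m (ℕP.m≤m+n m i))))

-- Laurent polynomials in q, X, Z over ℤ. An environment supplies every variable together with its inverse,
-- so that the shift Z ↦ q³ Z, Z⁻¹ ↦ q⁻³ Z⁻¹ becomes a definitional substitution (see ρ-suc).
module Laurent where

  data Var : Set where
    varQ varX varZ : Var

  record Env : Set where
    constructor env
    field
      value inverse : Var → ℚ

  open Env public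

  Valid : Env → Set
  Valid ρ = ∀ v → value ρ v * inverse ρ v ≡ 1ℚ

  infixl 6 _⊕_ _⊖_
  infixl 7 _⊗_
  infix  8 ⊝_
  infixr 9 _⊛_

  data Expr : Set where
    var var⁻¹ : Var → Expr
    one       : Expr
    num       : ℕ → Expr
    _⊕_ _⊖_ _⊗_ : Expr → Expr → Expr
    ⊝_        : Expr → Expr
    _⊛_       : Expr → ℕ → Expr

  natq : ℕ → ℚ
  natq zero    = 0ℚ
  natq (suc n) = 1ℚ + natq n

  ⟦_⟧ : Expr → Env → ℚ
  ⟦ var v ⟧   ρ = value ρ v
  ⟦ var⁻¹ v ⟧ ρ = inverse ρ v
  ⟦ one ⟧     ρ = 1ℚ
  ⟦ num k ⟧   ρ = natq k
  ⟦ e ⊕ f ⟧   ρ = ⟦ e ⟧ ρ + ⟦ f ⟧ ρ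
  ⟦ e ⊖ f ⟧   ρ = ⟦ e ⟧ ρ - ⟦ f ⟧ ρ
  ⟦ e ⊗ f ⟧   ρ = ⟦ e ⟧ ρ * ⟦ f ⟧ ρ
  ⟦ ⊝ e ⟧     ρ = - ⟦ e ⟧ ρ
  ⟦ e ⊛ k ⟧   ρ = ⟦ e ⟧ ρ ^ k

  record Mono : Set where
    constructor mono
    field
      degQ degX degZ : ℤ

  -- The coefficient is pos − neg; pairs of naturals keep normalisation of closed expressions cheap enough for refl.
  record Term : Set where
    constructor term
    field
      pos neg : ℕ
      monomial : Mono

  NF : Set
  NF = List Term

  evalMono : Env → Mono → ℚ
  evalMono ρ (mono a b c) = pow varQ a * (pow varX b * pow varZ c)
    where
    pow : Var → ℤ → ℚ
    pow v = laurent (value ρ v) (inverse ρ v)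

  coeff : ℕ → ℕ → ℚ
  coeff p n = natq p - natq n

  evalTerm : Env → Term → ℚ
  evalTerm ρ (term p n m) = coeff p n * evalMono ρ m

  evalNF : Env → NF → ℚ
  evalNF ρ []       = 0ℚ
  evalNF ρ (t ∷ ts) = evalTerm ρ t + evalNF ρ ts

  _≟ₘ_ : (m m′ : Mono) → Dec (m ≡ m′)
  mono a b c ≟ₘ mono a′ b′ c′ with a ℤP.≟ a′ | b ℤP.≟ b′ | c ℤP.≟ c′
  ... | yes refl | yes refl | yes refl = yes refl
  ... | no a≢a′  | _        | _        = no λ { refl → a≢a′ refl }
  ... | yes _    | no b≢b′  | _        = no λ { refl → b≢b′ refl }
  ... | yes _    | yes _    | no c≢c′  = no λ { refl → c≢c′ refl }

  -- Lexicographic order; it only serves to make normal forms canonical, soundness does not depend on it.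
  _<ₘ_ : Mono → Mono → Bool
  mono a b c <ₘ mono a′ b′ c′ =
    if does (a ℤP.<? a′) then true else if does (a′ ℤP.<? a) then false else
    if does (b ℤP.<? b′) then true else if does (b′ ℤP.<? b) then false else does (c ℤP.<? c′)

  -- insert x xs r ys merges x ∷ xs into ys, where r merges xs; this keeps the recursion structural.
  insert : Term → NF → (NF → NF) → NF → NF
  insert x xs r [] = x ∷ xs
  insert (term p n m) xs r (term p′ n′ m′ ∷ ys) with m ≟ₘ m′ | (p ℕ.+ p′) ℕ.≡ᵇ (n ℕ.+ n′) | m <ₘ m′
  ... | yes _ | true  | _     = r ys
  ... | yes _ | false | _     = term (p ℕ.+ p′) (n ℕ.+ n′) m ∷ r ys
  ... | no _  | _     | true  = term p n m ∷ r (term p′ n′ m′ ∷ ys)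
  ... | no _  | _     | false = term p′ n′ m′ ∷ insert (term p n m) xs r ys

  merge : NF → NF → NF
  merge []       ys = ys
  merge (x ∷ xs) ys = insert x xs (merge xs) ys

  negNF : NF → NF
  negNF []                = []
  negNF (term p n m ∷ xs) = term n p m ∷ negNF xs

  _·ₘ_ : Mono → Mono → Mono
  mono a b c ·ₘ mono a′ b′ c′ = mono (a ℤ.+ a′) (b ℤ.+ b′) (c ℤ.+ c′)

  scaleNF : Term → NF → NF
  scaleNF t                []                   = []
  scaleNF t@(term p n m)   (term p′ n′ m′ ∷ ys) =
    term (p ℕ.* p′ ℕ.+ n ℕ.* n′) (p ℕ.* n′ ℕ.+ n ℕ.* p′) (m ·ₘ m′) ∷ scaleNF t ys

  mulNF : NF → NF → NF
  mulNF []       ys = []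
  mulNF (x ∷ xs) ys = merge (scaleNF x ys) (mulNF xs ys)

  unitNF : NF
  unitNF = term 1 0 (mono (+ 0) (+ 0) (+ 0)) ∷ []

  powNF : NF → ℕ → NF
  powNF p zero    = unitNF
  powNF p (suc k) = mulNF p (powNF p k)

  varMono : Var → ℤ → Mono
  varMono varQ d = mono d (+ 0) (+ 0)
  varMono varX d = mono (+ 0) d (+ 0)
  varMono varZ d = mono (+ 0) (+ 0) d

  norm : Expr → NF
  norm (var v)       = term 1 0 (varMono v (+ 1)) ∷ []
  norm (var⁻¹ v)     = term 1 0 (varMono v -[1+ 0 ]) ∷ []
  norm one           = unitNF
  norm (num zero)    = []
  norm (num (suc k)) = term (suc k) 0 (mono (+ 0) (+ 0) (+ 0)) ∷ []
  norm (e ⊕ f)       = merge (norm e) (norm f)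
  norm (e ⊖ f)       = merge (norm e) (negNF (norm f))
  norm (e ⊗ f)       = mulNF (norm e) (norm f)
  norm (⊝ e)         = negNF (norm e)
  norm (e ⊛ k)       = powNF (norm e) k

  natq-+ : ∀ m n → natq (m ℕ.+ n) ≡ natq m + natq n
  natq-+ zero    n = sym (+-identityˡ (natq n))
  natq-+ (suc m) n = trans (cong (λ z → 1ℚ + z) (natq-+ m n)) (sym (+-assoc 1ℚ (natq m) (natq n)))

  natq-* : ∀ m n → natq (m ℕ.* n) ≡ natq m * natq n
  natq-* zero    n = sym (*-zeroˡ (natq n))
  natq-* (suc m) n = begin
    natq (n ℕ.+ m ℕ.* n)       ≡⟨ trans (natq-+ n (m ℕ.* n)) (cong (λ z → natq n + z) (natq-* m n)) ⟩
    natq n + natq m * natq n   ≡⟨ solve 2 (λ a b → b :+ a :* b := (con 1ℚ :+ a) :* b) refl (natq m) (natq n) ⟩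
    (1ℚ + natq m) * natq n     ∎

  coeff-+ : ∀ p n p′ n′ → coeff (p ℕ.+ p′) (n ℕ.+ n′) ≡ coeff p n + coeff p′ n′
  coeff-+ p n p′ n′ = trans (cong₂ _-_ (natq-+ p p′) (natq-+ n n′))
    (solve 4 (λ a b c d → (a :+ b) :- (c :+ d) := (a :- c) :+ (b :- d)) refl (natq p) (natq p′) (natq n) (natq n′))

  coeff-* : ∀ p n p′ n′ → coeff (p ℕ.* p′ ℕ.+ n ℕ.* n′) (p ℕ.* n′ ℕ.+ n ℕ.* p′) ≡ coeff p n * coeff p′ n′
  coeff-* p n p′ n′ = begin
    natq (p ℕ.* p′ ℕ.+ n ℕ.* n′) - natq (p ℕ.* n′ ℕ.+ n ℕ.* p′)
      ≡⟨ cong₂ _-_ (trans (natq-+ (p ℕ.* p′) (n ℕ.* n′)) (cong₂ _+_ (natq-* p p′) (natq-* n n′)))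
                   (trans (natq-+ (p ℕ.* n′) (n ℕ.* p′)) (cong₂ _+_ (natq-* p n′) (natq-* n p′))) ⟩
    (natq p * natq p′ + natq n * natq n′) - (natq p * natq n′ + natq n * natq p′)
      ≡⟨ solve 4 (λ a b c d → (a :* c :+ b :* d) :- (a :* d :+ b :* c) := (a :- b) :* (c :- d)) refl (natq p) (natq n) (natq p′) (natq n′) ⟩
    coeff p n * coeff p′ n′ ∎

  coeff-swap : ∀ p n → coeff n p ≡ - coeff p n
  coeff-swap p n = solve 2 (λ a b → b :- a := :- (a :- b)) refl (natq p) (natq n)

  coeff-≡ᵇ : ∀ p n → (p ℕ.≡ᵇ n) ≡ true → coeff p n ≡ 0ℚ
  coeff-≡ᵇ p n p≡ᵇn with ℕP.≡ᵇ⇒≡ p n (subst T (sym p≡ᵇn) _)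
  ... | refl = solve 1 (λ a → a :- a := con 0ℚ) refl (natq p)

  insert-sound : ∀ ρ x xs r → (∀ zs → evalNF ρ (r zs) ≡ evalNF ρ xs + evalNF ρ zs) →
                 ∀ ys → evalNF ρ (insert x xs r ys) ≡ (evalTerm ρ x + evalNF ρ xs) + evalNF ρ ys
  insert-sound ρ x xs r r-sound [] = sym (+-identityʳ _)
  insert-sound ρ (term p n m) xs r r-sound (term p′ n′ m′ ∷ ys)
    with m ≟ₘ m′ | (p ℕ.+ p′) ℕ.≡ᵇ (n ℕ.+ n′) in cancels | m <ₘ m′
  ... | yes refl | true | _ = begin
    evalNF ρ (r ys)                                  ≡⟨ r-sound ys ⟩
    X + Y                                            ≡⟨ solve 3 (λ M X Y → X :+ Y := con 0ℚ :* M :+ (X :+ Y)) refl M X Y ⟩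
    0ℚ * M + (X + Y)                                 ≡⟨ cong (λ c → c * M + (X + Y)) (sym (trans (sym (coeff-+ p n p′ n′)) (coeff-≡ᵇ (p ℕ.+ p′) (n ℕ.+ n′) cancels))) ⟩
    (coeff p n + coeff p′ n′) * M + (X + Y)          ≡⟨ solve 5 (λ a b M X Y → (a :+ b) :* M :+ (X :+ Y) := (a :* M :+ X) :+ (b :* M :+ Y)) refl (coeff p n) (coeff p′ n′) M X Y ⟩
    (coeff p n * M + X) + (coeff p′ n′ * M + Y)      ∎
    where M = evalMono ρ m; X = evalNF ρ xs; Y = evalNF ρ ys
  ... | yes refl | false | _ = begin
    coeff (p ℕ.+ p′) (n ℕ.+ n′) * M + evalNF ρ (r ys)  ≡⟨ cong₂ (λ c z → c * M + z) (coeff-+ p n p′ n′) (r-sound ys) ⟩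
    (coeff p n + coeff p′ n′) * M + (X + Y)            ≡⟨ solve 5 (λ a b M X Y → (a :+ b) :* M :+ (X :+ Y) := (a :* M :+ X) :+ (b :* M :+ Y)) refl (coeff p n) (coeff p′ n′) M X Y ⟩
    (coeff p n * M + X) + (coeff p′ n′ * M + Y)        ∎
    where M = evalMono ρ m; X = evalNF ρ xs; Y = evalNF ρ ys
  ... | no _ | _ | true = trans (cong (λ z → evalTerm ρ (term p n m) + z) (r-sound (term p′ n′ m′ ∷ ys)))
    (sym (+-assoc (evalTerm ρ (term p n m)) (evalNF ρ xs) _))
  ... | no _ | _ | false = begin
    B + evalNF ρ (insert (term p n m) xs r ys)  ≡⟨ cong (λ z → B + z) (insert-sound ρ (term p n m) xs r r-sound ys) ⟩
    B + (X + Y)                                 ≡⟨ solve 3 (λ B X Y → B :+ (X :+ Y) := X :+ (B :+ Y)) refl B X (evalNF ρ ys) ⟩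
    X + (B + evalNF ρ ys)                       ∎
    where B = evalTerm ρ (term p′ n′ m′); X = evalTerm ρ (term p n m) + evalNF ρ xs; Y = evalNF ρ ys

  merge-sound : ∀ ρ xs ys → evalNF ρ (merge xs ys) ≡ evalNF ρ xs + evalNF ρ ys
  merge-sound ρ []       ys = sym (+-identityˡ _)
  merge-sound ρ (x ∷ xs) ys = insert-sound ρ x xs (merge xs) (merge-sound ρ xs) ys

  negNF-sound : ∀ ρ xs → evalNF ρ (negNF xs) ≡ - evalNF ρ xs
  negNF-sound ρ []                = refl
  negNF-sound ρ (term p n m ∷ xs) = begin
    coeff n p * M + evalNF ρ (negNF xs)   ≡⟨ cong₂ (λ c z → c * M + z) (coeff-swap p n) (negNF-sound ρ xs) ⟩
    (- coeff p n) * M + - evalNF ρ xs     ≡⟨ solve 3 (λ a M X → (:- a) :* M :+ (:- X) := :- (a :* M :+ X)) refl (coeff p n) M (evalNF ρ xs) ⟩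
    - (coeff p n * M + evalNF ρ xs)       ∎
    where M = evalMono ρ m

  module _ {ρ : Env} (valid : Valid ρ) where

    evalMono-·ₘ : ∀ m m′ → evalMono ρ (m ·ₘ m′) ≡ evalMono ρ m * evalMono ρ m′
    evalMono-·ₘ (mono a b c) (mono a′ b′ c′) = begin
      Q (a ℤ.+ a′) * (X (b ℤ.+ b′) * Z (c ℤ.+ c′))
        ≡⟨ cong₂ _*_ (laurent-distrib-+ (valid varQ) a a′) (cong₂ _*_ (laurent-distrib-+ (valid varX) b b′) (laurent-distrib-+ (valid varZ) c c′)) ⟩
      (Q a * Q a′) * ((X b * X b′) * (Z c * Z c′))
        ≡⟨ solve 6 (λ A A′ B B′ C C′ → (A :* A′) :* ((B :* B′) :* (C :* C′)) := (A :* (B :* C)) :* (A′ :* (B′ :* C′))) refl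
             (Q a) (Q a′) (X b) (X b′) (Z c) (Z c′) ⟩
      (Q a * (X b * Z c)) * (Q a′ * (X b′ * Z c′)) ∎
      where
      Q X Z : ℤ → ℚ
      Q = laurent (value ρ varQ) (inverse ρ varQ)
      X = laurent (value ρ varX) (inverse ρ varX)
      Z = laurent (value ρ varZ) (inverse ρ varZ)

    scaleNF-sound : ∀ t ys → evalNF ρ (scaleNF t ys) ≡ evalTerm ρ t * evalNF ρ ys
    scaleNF-sound t            []                   = sym (*-zeroʳ (evalTerm ρ t))
    scaleNF-sound (term p n m) (term p′ n′ m′ ∷ ys) = begin
      coeff (p ℕ.* p′ ℕ.+ n ℕ.* n′) (p ℕ.* n′ ℕ.+ n ℕ.* p′) * evalMono ρ (m ·ₘ m′) + evalNF ρ (scaleNF (term p n m) ys)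
        ≡⟨ cong₂ _+_ (cong₂ _*_ (coeff-* p n p′ n′) (evalMono-·ₘ m m′)) (scaleNF-sound (term p n m) ys) ⟩
      (a * b) * (M * M′) + (a * M) * Y
        ≡⟨ solve 5 (λ a b M M′ Y → (a :* b) :* (M :* M′) :+ (a :* M) :* Y := (a :* M) :* (b :* M′ :+ Y)) refl a b M M′ Y ⟩
      (a * M) * (b * M′ + Y) ∎
      where a = coeff p n; b = coeff p′ n′; M = evalMono ρ m; M′ = evalMono ρ m′; Y = evalNF ρ ys

    mulNF-sound : ∀ xs ys → evalNF ρ (mulNF xs ys) ≡ evalNF ρ xs * evalNF ρ ys
    mulNF-sound []       ys = sym (*-zeroˡ (evalNF ρ ys))
    mulNF-sound (x ∷ xs) ys = begin
      evalNF ρ (merge (scaleNF x ys) (mulNF xs ys))          ≡⟨ merge-sound ρ (scaleNF x ys) (mulNF xs ys) ⟩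
      evalNF ρ (scaleNF x ys) + evalNF ρ (mulNF xs ys)       ≡⟨ cong₂ _+_ (scaleNF-sound x ys) (mulNF-sound xs ys) ⟩
      evalTerm ρ x * evalNF ρ ys + evalNF ρ xs * evalNF ρ ys ≡⟨ sym (*-distribʳ-+ (evalNF ρ ys) (evalTerm ρ x) (evalNF ρ xs)) ⟩
      (evalTerm ρ x + evalNF ρ xs) * evalNF ρ ys             ∎

    powNF-sound : ∀ xs k → evalNF ρ (powNF xs k) ≡ evalNF ρ xs ^ k
    powNF-sound xs zero    = refl
    powNF-sound xs (suc k) = trans (mulNF-sound xs (powNF xs k)) (cong (evalNF ρ xs *_) (powNF-sound xs k))

    var-sound : ∀ v d → laurent (value ρ v) (inverse ρ v) d ≡ evalNF ρ (term 1 0 (varMono v d) ∷ [])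
    var-sound varQ d = solve 1 (λ a → a := con 1ℚ :* (a :* (con 1ℚ :* con 1ℚ)) :+ con 0ℚ) refl _
    var-sound varX d = solve 1 (λ a → a := con 1ℚ :* (con 1ℚ :* (a :* con 1ℚ)) :+ con 0ℚ) refl _
    var-sound varZ d = solve 1 (λ a → a := con 1ℚ :* (con 1ℚ :* (con 1ℚ :* a)) :+ con 0ℚ) refl _

    norm-sound : ∀ e → ⟦ e ⟧ ρ ≡ evalNF ρ (norm e)
    norm-sound (var v)       = trans (sym (*-identityʳ (value ρ v))) (var-sound v (+ 1))
    norm-sound (var⁻¹ v)     = trans (sym (*-identityʳ (inverse ρ v))) (var-sound v -[1+ 0 ])
    norm-sound one           = refl
    norm-sound (num zero)    = refl
    norm-sound (num (suc k)) = solve 1 (λ a → a := (a :- con 0ℚ) :* con 1ℚ :+ con 0ℚ) refl (natq (suc k))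
    norm-sound (e ⊕ f)       = trans (cong₂ _+_ (norm-sound e) (norm-sound f)) (sym (merge-sound ρ (norm e) (norm f)))
    norm-sound (e ⊖ f)       = begin
      ⟦ e ⟧ ρ - ⟦ f ⟧ ρ                                ≡⟨ cong₂ _-_ (norm-sound e) (norm-sound f) ⟩
      evalNF ρ (norm e) - evalNF ρ (norm f)            ≡⟨ cong (λ z → evalNF ρ (norm e) + z) (sym (negNF-sound ρ (norm f))) ⟩
      evalNF ρ (norm e) + evalNF ρ (negNF (norm f))    ≡⟨ sym (merge-sound ρ (norm e) (negNF (norm f))) ⟩
      evalNF ρ (merge (norm e) (negNF (norm f)))       ∎
    norm-sound (e ⊗ f)       = trans (cong₂ _*_ (norm-sound e) (norm-sound f)) (sym (mulNF-sound (norm e) (norm f)))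
    norm-sound (⊝ e)         = trans (cong -_ (norm-sound e)) (sym (negNF-sound ρ (norm e)))
    norm-sound (e ⊛ k)       = trans (cong (_^ k) (norm-sound e)) (sym (powNF-sound (norm e) k))

    norm≡[]⇒⟦⟧≡0 : ∀ e → norm e ≡ [] → ⟦ e ⟧ ρ ≡ 0ℚ
    norm≡[]⇒⟦⟧≡0 e norm-e≡[] = trans (norm-sound e) (cong (evalNF ρ) norm-e≡[])

-- Certificates

open Laurent

qₑ q⁻¹ₑ Xₑ Zₑ Wₑ : Expr
qₑ   = var varQ
q⁻¹ₑ = var⁻¹ varQ
Xₑ   = var varX
Zₑ   = var varZ
Wₑ   = var⁻¹ varZ

vars : ℚ → ℚ → ℚ → Var → ℚ
vars q X Z varQ = q
vars q X Z varX = X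
vars q X Z varZ = Z

pochₑ : Expr → Expr → ℕ → Expr
pochₑ a b zero    = one
pochₑ a b (suc L) = pochₑ a b L ⊗ (one ⊖ a ⊗ b ⊛ L)

⟦pochₑ⟧ : ∀ a b L ρ → ⟦ pochₑ a b L ⟧ ρ ≡ poch (⟦ a ⟧ ρ) (⟦ b ⟧ ρ) L
⟦pochₑ⟧ a b zero    ρ = refl
⟦pochₑ⟧ a b (suc L) ρ = cong (_* (1ℚ - ⟦ a ⟧ ρ * ⟦ b ⟧ ρ ^ L)) (⟦pochₑ⟧ a b L ρ)

sumₑ : ℕ → (ℕ → Expr) → Expr
sumₑ zero    f = num 0
sumₑ (suc m) f = sumₑ m f ⊕ f m

⟦sumₑ⟧ : ∀ m f ρ → ⟦ sumₑ m f ⟧ ρ ≡ sumTo m (λ i → ⟦ f i ⟧ ρ)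
⟦sumₑ⟧ zero    f ρ = refl
⟦sumₑ⟧ (suc m) f ρ = cong (_+ ⟦ f m ⟧ ρ) (⟦sumₑ⟧ m f ρ)

sgnₑ : ℕ → Expr
sgnₑ zero    = one
sgnₑ (suc j) = ⊝ sgnₑ j

⟦sgnₑ⟧ : ∀ j ρ → ⟦ sgnₑ j ⟧ ρ ≡ sgn j
⟦sgnₑ⟧ zero    ρ = refl
⟦sgnₑ⟧ (suc j) ρ = cong -_ (⟦sgnₑ⟧ j ρ)

telescoping-step : ∀ {ρ} → Valid ρ → ∀ d (c F : ℕ → Expr) (g₀ g₁ : Expr) →
  norm (sumₑ d (λ i → c i ⊗ F i) ⊕ g₀ ⊕ g₁) ≡ [] →
  ∀ (B G₀ G₁ : ℚ) (f : ℕ → ℚ) → (∀ i → i < d → f i ≡ B * ⟦ F i ⟧ ρ) →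
  G₀ ≡ B * ⟦ g₀ ⟧ ρ → G₁ ≡ - (B * ⟦ g₁ ⟧ ρ) →
  sumTo d (λ i → ⟦ c i ⟧ ρ * f i) ≡ G₁ - G₀
telescoping-step {ρ} valid d c F g₀ g₁ identity B G₀ G₁ f f≡ G₀≡ G₁≡ = begin
  sumTo d (λ i → ⟦ c i ⟧ ρ * f i)                   ≡⟨ sumTo-cong d (λ i i<d → trans (cong (⟦ c i ⟧ ρ *_) (f≡ i i<d))
                                                          (solve 3 (λ c B F → c :* (B :* F) := B :* (c :* F)) refl (⟦ c i ⟧ ρ) B (⟦ F i ⟧ ρ))) ⟩
  sumTo d (λ i → B * (⟦ c i ⟧ ρ * ⟦ F i ⟧ ρ))       ≡⟨ sym (*-distribˡ-sumTo d B _) ⟩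
  B * sumTo d (λ i → ⟦ c i ⊗ F i ⟧ ρ)               ≡⟨ cong (B *_) (sym (⟦sumₑ⟧ d (λ i → c i ⊗ F i) ρ)) ⟩
  B * S                                             ≡⟨ solve 4 (λ B S a b → B :* S := B :* (S :+ a :+ b) :- B :* b :- B :* a) refl B S a b ⟩
  B * (S + a + b) - B * b - B * a                   ≡⟨ cong (λ z → B * z - B * b - B * a) (norm≡[]⇒⟦⟧≡0 valid (sumₑ d (λ i → c i ⊗ F i) ⊕ g₀ ⊕ g₁) identity) ⟩
  B * 0ℚ - B * b - B * a                            ≡⟨ solve 3 (λ B a b → B :* con 0ℚ :- B :* b :- B :* a := :- (B :* b) :- B :* a) refl B a b ⟩
  - (B * b) - B * a                                 ≡⟨ cong₂ _-_ (sym G₁≡) (sym G₀≡) ⟩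
  G₁ - G₀                                           ∎
  where
  S = ⟦ sumₑ d (λ i → c i ⊗ F i) ⟧ ρ
  a = ⟦ g₀ ⟧ ρ
  b = ⟦ g₁ ⟧ ρ

-- The coefficients cᵢ(q, X) of the recurrence, and the numerators of the telescoping certificates of the two
-- sides as functions of (X, Z, Z⁻¹), so that they can be shifted from j to j + 1.
recCoeffₑ : ℕ → Expr
recCoeffₑ 0 =
  qₑ ⊛ 7 ⊗ Xₑ ⊛ 4 ⊖ qₑ ⊛ 8 ⊗ Xₑ ⊛ 6 ⊖ qₑ ⊛ 9 ⊗ Xₑ ⊛ 6 ⊕ qₑ ⊛ 10 ⊗ Xₑ ⊛ 8
recCoeffₑ 1 =
  qₑ ⊛ 2 ⊗ Xₑ ⊛ 2 ⊕ qₑ ⊛ 8 ⊗ Xₑ ⊛ 2 ⊕ qₑ ⊛ 8 ⊗ Xₑ ⊛ 4 ⊕ qₑ ⊛ 9 ⊗ Xₑ ⊛ 4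
  ⊖ qₑ ⊛ 9 ⊗ Xₑ ⊛ 6 ⊖ qₑ ⊛ 10 ⊗ Xₑ ⊛ 6 ⊖ qₑ ⊛ 11 ⊗ Xₑ ⊛ 6 ⊖ qₑ ⊛ 12 ⊗ Xₑ ⊛ 6
recCoeffₑ 2 =
  qₑ ⊕ qₑ ⊛ 4 ⊗ Xₑ ⊛ 2 ⊕ qₑ ⊛ 5 ⊗ Xₑ ⊛ 2 ⊕ qₑ ⊛ 7 ⊗ Xₑ ⊛ 4
  ⊕ qₑ ⊛ 8 ⊗ Xₑ ⊛ 4 ⊕ num 2 ⊗ qₑ ⊛ 9 ⊗ Xₑ ⊛ 4 ⊕ qₑ ⊛ 10 ⊗ Xₑ ⊛ 4 ⊕ qₑ ⊛ 11 ⊗ Xₑ ⊛ 4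
recCoeffₑ 3 =
  ⊝ one ⊖ qₑ ⊖ qₑ ⊛ 4 ⊗ Xₑ ⊛ 2 ⊖ qₑ ⊛ 5 ⊗ Xₑ ⊛ 2
  ⊖ qₑ ⊛ 6 ⊗ Xₑ ⊛ 2 ⊖ qₑ ⊛ 7 ⊗ Xₑ ⊛ 2
recCoeffₑ 4 = one
recCoeffₑ _ = num 0

rhsCertₑ : Expr → Expr → Expr → Expr
rhsCertₑ x z w =
  ⊝ qₑ ⊛ 8 ⊗ x ⊛ 2 ⊖ qₑ ⊛ 2 ⊗ x ⊛ 2 ⊗ z ⊛ 2 ⊕ qₑ ⊛ 4 ⊗ x ⊛ 3 ⊗ z ⊕ qₑ ⊛ 5 ⊗ x ⊛ 3 ⊗ z
  ⊕ qₑ ⊛ 6 ⊗ x ⊛ 3 ⊗ z ⊕ qₑ ⊛ 7 ⊗ x ⊛ 3 ⊗ z ⊕ qₑ ⊛ 8 ⊗ x ⊛ 3 ⊗ z ⊕ qₑ ⊛ 9 ⊗ x ⊛ 3 ⊗ z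
  ⊖ qₑ ⊛ 7 ⊗ x ⊛ 4 ⊖ qₑ ⊛ 8 ⊗ x ⊛ 4 ⊕ qₑ ⊛ 10 ⊗ x ⊛ 4 ⊕ qₑ ⊛ 3 ⊗ x ⊛ 4 ⊗ z ⊛ 2
  ⊕ qₑ ⊛ 4 ⊗ x ⊛ 4 ⊗ z ⊛ 2 ⊖ qₑ ⊛ 7 ⊗ x ⊛ 4 ⊗ z ⊛ 2 ⊖ qₑ ⊛ 8 ⊗ x ⊛ 4 ⊗ z ⊛ 2 ⊖ qₑ ⊛ 9 ⊗ x ⊛ 4 ⊗ z ⊛ 2
  ⊕ qₑ ⊛ 11 ⊗ x ⊛ 5 ⊗ w ⊖ qₑ ⊛ 5 ⊗ x ⊛ 5 ⊗ z ⊖ num 2 ⊗ qₑ ⊛ 6 ⊗ x ⊛ 5 ⊗ z ⊖ num 2 ⊗ qₑ ⊛ 7 ⊗ x ⊛ 5 ⊗ z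
  ⊖ num 2 ⊗ qₑ ⊛ 8 ⊗ x ⊛ 5 ⊗ z ⊖ num 2 ⊗ qₑ ⊛ 9 ⊗ x ⊛ 5 ⊗ z ⊖ num 2 ⊗ qₑ ⊛ 10 ⊗ x ⊛ 5 ⊗ z ⊖ qₑ ⊛ 11 ⊗ x ⊛ 5 ⊗ z
  ⊕ qₑ ⊛ 8 ⊗ x ⊛ 5 ⊗ z ⊛ 3 ⊕ qₑ ⊛ 8 ⊗ x ⊛ 6 ⊕ num 2 ⊗ qₑ ⊛ 9 ⊗ x ⊛ 6 ⊕ num 2 ⊗ qₑ ⊛ 10 ⊗ x ⊛ 6
  ⊖ qₑ ⊛ 5 ⊗ x ⊛ 6 ⊗ z ⊛ 2 ⊕ qₑ ⊛ 8 ⊗ x ⊛ 6 ⊗ z ⊛ 2 ⊕ num 2 ⊗ qₑ ⊛ 9 ⊗ x ⊛ 6 ⊗ z ⊛ 2 ⊕ num 2 ⊗ qₑ ⊛ 10 ⊗ x ⊛ 6 ⊗ z ⊛ 2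
  ⊕ qₑ ⊛ 11 ⊗ x ⊛ 6 ⊗ z ⊛ 2 ⊖ qₑ ⊛ 12 ⊗ x ⊛ 7 ⊗ w ⊖ qₑ ⊛ 13 ⊗ x ⊛ 7 ⊗ w ⊕ qₑ ⊛ 7 ⊗ x ⊛ 7 ⊗ z
  ⊕ qₑ ⊛ 8 ⊗ x ⊛ 7 ⊗ z ⊕ qₑ ⊛ 9 ⊗ x ⊛ 7 ⊗ z ⊕ qₑ ⊛ 10 ⊗ x ⊛ 7 ⊗ z ⊕ qₑ ⊛ 11 ⊗ x ⊛ 7 ⊗ z
  ⊕ qₑ ⊛ 12 ⊗ x ⊛ 7 ⊗ z ⊖ qₑ ⊛ 9 ⊗ x ⊛ 7 ⊗ z ⊛ 3 ⊖ qₑ ⊛ 10 ⊗ x ⊛ 7 ⊗ z ⊛ 3 ⊖ qₑ ⊛ 10 ⊗ x ⊛ 8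
  ⊖ qₑ ⊛ 11 ⊗ x ⊛ 8 ⊖ qₑ ⊛ 12 ⊗ x ⊛ 8 ⊖ qₑ ⊛ 10 ⊗ x ⊛ 8 ⊗ z ⊛ 2 ⊖ qₑ ⊛ 11 ⊗ x ⊛ 8 ⊗ z ⊛ 2
  ⊖ qₑ ⊛ 12 ⊗ x ⊛ 8 ⊗ z ⊛ 2 ⊕ qₑ ⊛ 14 ⊗ x ⊛ 9 ⊗ w ⊕ qₑ ⊛ 11 ⊗ x ⊛ 9 ⊗ z ⊛ 3

lhsCertₑ : Expr → Expr → Expr → Expr
lhsCertₑ x z w =
  qₑ ⊛ 5 ⊗ x ⊛ 2 ⊖ qₑ ⊛ 8 ⊗ x ⊛ 2 ⊗ w ⊛ 2 ⊖ qₑ ⊛ 5 ⊗ x ⊛ 2 ⊗ z ⊛ 2 ⊕ qₑ ⊛ 8 ⊗ x ⊛ 2 ⊗ z ⊛ 2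
  ⊕ qₑ ⊛ 10 ⊗ x ⊛ 3 ⊗ w ⊕ qₑ ⊛ 11 ⊗ x ⊛ 3 ⊗ w ⊕ qₑ ⊛ 12 ⊗ x ⊛ 3 ⊗ w ⊖ qₑ ⊛ 10 ⊗ x ⊛ 3 ⊗ z
  ⊖ qₑ ⊛ 11 ⊗ x ⊛ 3 ⊗ z ⊖ qₑ ⊛ 12 ⊗ x ⊛ 3 ⊗ z ⊖ qₑ ⊛ 7 ⊗ x ⊛ 4 ⊕ qₑ ⊛ 13 ⊗ x ⊛ 4
  ⊕ qₑ ⊛ 14 ⊗ x ⊛ 4 ⊕ qₑ ⊛ 15 ⊗ x ⊛ 4 ⊕ qₑ ⊛ 10 ⊗ x ⊛ 4 ⊗ w ⊛ 2 ⊖ qₑ ⊛ 13 ⊗ x ⊛ 4 ⊗ w ⊛ 2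
  ⊖ qₑ ⊛ 14 ⊗ x ⊛ 4 ⊗ w ⊛ 2 ⊖ qₑ ⊛ 15 ⊗ x ⊛ 4 ⊗ w ⊛ 2 ⊕ qₑ ⊛ 7 ⊗ x ⊛ 4 ⊗ z ⊛ 2 ⊖ qₑ ⊛ 10 ⊗ x ⊛ 4 ⊗ z ⊛ 2
  ⊖ qₑ ⊛ 8 ⊗ x ⊛ 5 ⊗ w ⊖ qₑ ⊛ 11 ⊗ x ⊛ 5 ⊗ w ⊖ qₑ ⊛ 12 ⊗ x ⊛ 5 ⊗ w ⊖ qₑ ⊛ 13 ⊗ x ⊛ 5 ⊗ w
  ⊖ qₑ ⊛ 14 ⊗ x ⊛ 5 ⊗ w ⊖ qₑ ⊛ 17 ⊗ x ⊛ 5 ⊗ w ⊕ qₑ ⊛ 8 ⊗ x ⊛ 5 ⊗ z ⊕ qₑ ⊛ 12 ⊗ x ⊛ 5 ⊗ z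
  ⊕ qₑ ⊛ 13 ⊗ x ⊛ 5 ⊗ z ⊕ qₑ ⊛ 14 ⊗ x ⊛ 5 ⊗ z ⊕ qₑ ⊛ 11 ⊗ x ⊛ 5 ⊗ w ⊛ 3 ⊕ qₑ ⊛ 17 ⊗ x ⊛ 5 ⊗ w ⊛ 3
  ⊖ qₑ ⊛ 15 ⊗ x ⊛ 6 ⊖ qₑ ⊛ 16 ⊗ x ⊛ 6 ⊖ qₑ ⊛ 17 ⊗ x ⊛ 6 ⊕ qₑ ⊛ 15 ⊗ x ⊛ 6 ⊗ w ⊛ 2
  ⊕ qₑ ⊛ 16 ⊗ x ⊛ 6 ⊗ w ⊛ 2 ⊕ qₑ ⊛ 17 ⊗ x ⊛ 6 ⊗ w ⊛ 2 ⊕ qₑ ⊛ 10 ⊗ x ⊛ 7 ⊗ w ⊕ qₑ ⊛ 13 ⊗ x ⊛ 7 ⊗ w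
  ⊕ qₑ ⊛ 19 ⊗ x ⊛ 7 ⊗ w ⊖ qₑ ⊛ 10 ⊗ x ⊛ 7 ⊗ z ⊖ qₑ ⊛ 13 ⊗ x ⊛ 7 ⊗ w ⊛ 3 ⊖ qₑ ⊛ 19 ⊗ x ⊛ 7 ⊗ w ⊛ 3

-- F(n + i, j) / B(n, j) for the summands F of the right and of the left side (see rhsTerm-shift, lhsTerm-shift).
rhsShiftₑ : ℕ → Expr
rhsShiftₑ i = Zₑ ⊛ 2 ⊗ pochₑ (qₑ ⊗ Xₑ ⊛ 2) qₑ (2 ℕ.* i)
  ⊗ pochₑ (qₑ ⊛ suc i ⊗ Xₑ ⊗ Zₑ) qₑ (4 ℕ.∸ i) ⊗ pochₑ (qₑ ⊛ suc i ⊗ Xₑ ⊗ Wₑ) qₑ (4 ℕ.∸ i)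

rhs-telescoping-identity :
  norm (sumₑ 5 (λ i → recCoeffₑ i ⊗ rhsShiftₑ i)
        ⊕ pochₑ (qₑ ⊛ 2 ⊗ Xₑ ⊗ Zₑ) qₑ 3 ⊗ rhsCertₑ Xₑ Zₑ Wₑ
        ⊕ Zₑ ⊛ 2 ⊗ pochₑ (qₑ ⊛ 2 ⊗ Xₑ ⊗ Wₑ) qₑ 3 ⊗ rhsCertₑ Xₑ (qₑ ⊛ 3 ⊗ Zₑ) (q⁻¹ₑ ⊛ 3 ⊗ Wₑ)) ≡ []
rhs-telescoping-identity = refl

lhsShiftₑ : ℕ → Expr
lhsShiftₑ i = (one ⊖ qₑ ⊛ (2 ℕ.* i) ⊗ Xₑ ⊛ 2) ⊗ pochₑ (Xₑ ⊛ 3 ⊗ Wₑ) (qₑ ⊛ 3) i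
  ⊗ pochₑ (qₑ ⊛ suc i ⊗ Xₑ ⊗ Wₑ) qₑ (4 ℕ.∸ i) ⊗ (one ⊖ qₑ ⊛ 6 ⊗ Zₑ ⊛ 2)

lhs-telescoping-identity :
  norm (sumₑ 5 (λ i → recCoeffₑ i ⊗ lhsShiftₑ i)
        ⊕ pochₑ (Xₑ ⊛ 3 ⊗ Wₑ) (qₑ ⊛ 3) 1 ⊗ (one ⊖ qₑ ⊛ 6 ⊗ Zₑ ⊛ 2) ⊗ lhsCertₑ Xₑ Zₑ Wₑ
        ⊕ Zₑ ⊛ 2 ⊗ pochₑ (qₑ ⊛ 2 ⊗ Xₑ ⊗ Wₑ) qₑ 3 ⊗ lhsCertₑ Xₑ (qₑ ⊛ 3 ⊗ Zₑ) (q⁻¹ₑ ⊛ 3 ⊗ Wₑ)) ≡ []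
lhs-telescoping-identity = refl

lhsCert-at-Z=1 : norm (lhsCertₑ Xₑ one one) ≡ []
lhsCert-at-Z=1 = refl

-- The summands of both sides multiplied by (q;q)₂ₙ (q⁶;q⁶)₂, which makes them polynomials in q when n ≤ 8.
lhsClearedₑ : ℕ → ℕ → Expr
lhsClearedₑ n j with 3 ℕ.* j ℕ.≤? n
... | yes _ = sgnₑ j ⊗ pochₑ (qₑ ⊛ 3) (qₑ ⊛ 3) (n ℕ.∸ j ℕ.∸ 1) ⊗ (one ⊖ qₑ ⊛ (2 ℕ.* n)) ⊗ qₑ ⊛ (3 ℕ.* j ℕ.* j ℕ.∸ 3 ℕ.* j)
              ⊗ pochₑ (qₑ ⊗ qₑ ⊛ (n ℕ.∸ 3 ℕ.* j)) qₑ (2 ℕ.* n ℕ.∸ (n ℕ.∸ 3 ℕ.* j))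
              ⊗ pochₑ (qₑ ⊛ 6 ⊗ (qₑ ⊛ 6) ⊛ j) (qₑ ⊛ 6) (2 ℕ.∸ j)
... | no  _ = num 0

rhsClearedₑ : ℕ → ℤ → Expr
rhsClearedₑ n j with 3 ℕ.* ℤ.∣ j ∣ ℕ.≤? n
... | yes _ = sgnₑ ℤ.∣ j ∣ ⊗ qₑ ⊛ (3 ℕ.* ℤ.∣ j ℤ.* (j ℤ.+ + 1) ∣)
              ⊗ pochₑ (qₑ ⊗ qₑ ⊛ (n ℕ.+ 3 ℕ.* ℤ.∣ j ∣)) qₑ (n ℕ.∸ 3 ℕ.* ℤ.∣ j ∣)
              ⊗ pochₑ (qₑ ⊗ qₑ ⊛ (n ℕ.∸ 3 ℕ.* ℤ.∣ j ∣)) qₑ (n ℕ.+ 3 ℕ.* ℤ.∣ j ∣)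
              ⊗ pochₑ (qₑ ⊛ 6) (qₑ ⊛ 6) 2
... | no  _ = num 0

clearedDifferenceₑ : ℕ → Expr
clearedDifferenceₑ n = sumₑ (suc n) (lhsClearedₑ n) ⊖ sumₑ (suc (2 ℕ.* n)) (λ i → rhsClearedₑ n (+ i ℤ.- + n))

initial-identities : ∀ n → 1 ≤ n → n ≤ 6 → norm (clearedDifferenceₑ n) ≡ []
initial-identities 1 _ _ = refl
initial-identities 2 _ _ = refl
initial-identities 3 _ _ = refl
initial-identities 4 _ _ = refl
initial-identities 5 _ _ = refl
initial-identities 6 _ _ = refl
initial-identities (suc (suc (suc (suc (suc (suc (suc _))))))) _ (s≤s (s≤s (s≤s (s≤s (s≤s (s≤s ()))))))

module Generic (q : ℚ) (q≢0 : q ≢ 0ℚ) (q^k≢1 : ∀ (k : ℕ) → 1 ≤ k → q ^ k ≢ 1ℚ) where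

  q⁻¹ : ℚ
  q⁻¹ = inv q

  q*q⁻¹≡1 : q * q⁻¹ ≡ 1ℚ
  q*q⁻¹≡1 = inv-inverseʳ q q≢0

  q^ℤ : ℤ → ℚ
  q^ℤ = laurent q q⁻¹

  q^ℤ-+ : ∀ a b → q^ℤ (a ℤ.+ b) ≡ q^ℤ a * q^ℤ b
  q^ℤ-+ = laurent-distrib-+ q*q⁻¹≡1

  1-q^[1+k]≢0 : ∀ k → 1ℚ - q ^ suc k ≢ 0ℚ
  1-q^[1+k]≢0 k = 1-x≢0 (q^k≢1 (suc k) (s≤s z≤n))

  1-q⁶⁽ʲ⁺¹⁾≢0 : ∀ j → 1ℚ - q ^ 6 * (q ^ 6) ^ j ≢ 0ℚ
  1-q⁶⁽ʲ⁺¹⁾≢0 j = subst (λ x → 1ℚ - x ≢ 0ℚ) (trans (^-distribˡ-+-* q 6 (6 ℕ.* j)) (cong (q ^ 6 *_) (sym (^-*-assoc q 6 j))))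
    (1-q^[1+k]≢0 (5 ℕ.+ 6 ℕ.* j))

  poch-q-≢0 : ∀ N → poch q q N ≢ 0ℚ
  poch-q-≢0 N = poch-≢0 q q N (λ k _ → 1-q^[1+k]≢0 k)

  poch-q⁶-≢0 : ∀ N → poch (q ^ 6) (q ^ 6) N ≢ 0ℚ
  poch-q⁶-≢0 N = poch-≢0 (q ^ 6) (q ^ 6) N (λ k _ → 1-q⁶⁽ʲ⁺¹⁾≢0 k)

  qfac⁻¹ : ℤ → ℚ
  qfac⁻¹ (+ m)    = inv (poch q q m)
  qfac⁻¹ -[1+ m ] = 0ℚ

  qfac⁻¹-step : ∀ a → qfac⁻¹ a ≡ (1ℚ - q^ℤ (a ℤ.+ + 1)) * qfac⁻¹ (a ℤ.+ + 1)
  qfac⁻¹-step (+ m) rewrite ℕP.+-comm m 1 = inv[P]≡x*inv[P*x] (poch q q m) (1ℚ - q ^ suc m) (1-q^[1+k]≢0 m)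
  qfac⁻¹-step -[1+ zero ]  = refl
  qfac⁻¹-step -[1+ suc m ] = sym (*-zeroʳ (1ℚ - q^ℤ (-[1+ suc m ] ℤ.+ + 1)))

  qfac⁻¹-shift : ∀ a d → qfac⁻¹ a ≡ poch (q^ℤ (a ℤ.+ + 1)) q d * qfac⁻¹ (a ℤ.+ + d)
  qfac⁻¹-shift a zero    = sym (trans (*-identityˡ _) (cong qfac⁻¹ (ℤP.+-identityʳ a)))
  qfac⁻¹-shift a (suc d) = begin
    qfac⁻¹ a                                                   ≡⟨ qfac⁻¹-shift a d ⟩
    P * qfac⁻¹ (a ℤ.+ + d)                                     ≡⟨ cong (P *_) (qfac⁻¹-step (a ℤ.+ + d)) ⟩
    P * ((1ℚ - q^ℤ (a ℤ.+ + d ℤ.+ + 1)) * qfac⁻¹ (a ℤ.+ + d ℤ.+ + 1))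
      ≡⟨ cong₂ (λ e b → P * ((1ℚ - e) * qfac⁻¹ b)) (trans (cong q^ℤ (reorder a (+ d))) (q^ℤ-+ (a ℤ.+ + 1) (+ d))) last ⟩
    P * ((1ℚ - q^ℤ (a ℤ.+ + 1) * q ^ d) * qfac⁻¹ (a ℤ.+ + suc d))  ≡⟨ sym (*-assoc P _ _) ⟩
    poch (q^ℤ (a ℤ.+ + 1)) q (suc d) * qfac⁻¹ (a ℤ.+ + suc d)  ∎
    where
    P = poch (q^ℤ (a ℤ.+ + 1)) q d
    reorder : ∀ a d → a ℤ.+ d ℤ.+ + 1 ≡ a ℤ.+ + 1 ℤ.+ d
    reorder = solve-∀
    last : a ℤ.+ + d ℤ.+ + 1 ≡ a ℤ.+ + suc d
    last = trans (ℤP.+-assoc a (+ d) (+ 1)) (cong (λ k → a ℤ.+ + k) (ℕP.+-comm d 1))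

  qfac⁻¹-lift : ∀ n i m u → i ≤ m →
    qfac⁻¹ (+ (n ℕ.+ i) ℤ.+ u) ≡ poch (q ^ suc i * q ^ n * q^ℤ u) q (m ℕ.∸ i) * qfac⁻¹ (+ (n ℕ.+ m) ℤ.+ u)
  qfac⁻¹-lift n i m u i≤m = trans (qfac⁻¹-shift (+ (n ℕ.+ i) ℤ.+ u) (m ℕ.∸ i))
    (cong₂ (λ a b → poch a q (m ℕ.∸ i) * qfac⁻¹ b) start end)
    where
    reorder : ∀ n i u → n ℤ.+ i ℤ.+ u ℤ.+ + 1 ≡ + 1 ℤ.+ i ℤ.+ n ℤ.+ u
    reorder = solve-∀
    swap : ∀ a u b → a ℤ.+ u ℤ.+ b ≡ a ℤ.+ b ℤ.+ u
    swap = solve-∀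
    start : q^ℤ (+ (n ℕ.+ i) ℤ.+ u ℤ.+ + 1) ≡ q ^ suc i * q ^ n * q^ℤ u
    start = begin
      q^ℤ (+ (n ℕ.+ i) ℤ.+ u ℤ.+ + 1)       ≡⟨ cong (λ k → q^ℤ (k ℤ.+ u ℤ.+ + 1)) (ℤP.pos-+ n i) ⟩
      q^ℤ (+ n ℤ.+ + i ℤ.+ u ℤ.+ + 1)       ≡⟨ cong q^ℤ (reorder (+ n) (+ i) u) ⟩
      q^ℤ (+ 1 ℤ.+ + i ℤ.+ + n ℤ.+ u)       ≡⟨ q^ℤ-+ (+ 1 ℤ.+ + i ℤ.+ + n) u ⟩
      q^ℤ (+ 1 ℤ.+ + i ℤ.+ + n) * q^ℤ u     ≡⟨ cong (_* q^ℤ u) (q^ℤ-+ (+ 1 ℤ.+ + i) (+ n)) ⟩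
      q ^ suc i * q ^ n * q^ℤ u             ∎
    end : + (n ℕ.+ i) ℤ.+ u ℤ.+ + (m ℕ.∸ i) ≡ + (n ℕ.+ m) ℤ.+ u
    end = begin
      + (n ℕ.+ i) ℤ.+ u ℤ.+ + (m ℕ.∸ i)     ≡⟨ swap (+ (n ℕ.+ i)) u (+ (m ℕ.∸ i)) ⟩
      + (n ℕ.+ i) ℤ.+ + (m ℕ.∸ i) ℤ.+ u     ≡⟨ cong (ℤ._+ u) (sym (ℤP.pos-+ (n ℕ.+ i) (m ℕ.∸ i))) ⟩
      + (n ℕ.+ i ℕ.+ (m ℕ.∸ i)) ℤ.+ u       ≡⟨ cong (λ k → + k ℤ.+ u) (trans (ℕP.+-assoc n i (m ℕ.∸ i)) (cong (n ℕ.+_) (ℕP.m+[n∸m]≡n i≤m))) ⟩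
      + (n ℕ.+ m) ℤ.+ u                     ∎

  qfac⁻¹-⊖ : ∀ a b → a < b → qfac⁻¹ (a ℤ.⊖ b) ≡ 0ℚ
  qfac⁻¹-⊖ a b a<b rewrite ℤP.⊖-< a<b with b ℕ.∸ a | ℕP.m>n⇒m∸n≢0 a<b
  ... | zero  | b∸a≢0 = ⊥-elim (b∸a≢0 refl)
  ... | suc _ | _     = refl

  qbinomℤ-qfac⁻¹ : ∀ A K N → A ℤ.+ K ≡ + N → qbinomℤ q A K ≡ poch q q N * (qfac⁻¹ A * qfac⁻¹ K)
  qbinomℤ-qfac⁻¹ (+ a)    (+ k)    N a+k≡N with ℤP.+-injective a+k≡N
  ... | refl = cong (poch q q (a ℕ.+ k) *_) (inv-distrib-* (poch q q a) (poch q q k))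
  qbinomℤ-qfac⁻¹ (+ a)    -[1+ k ] N _ = sym (trans (cong (poch q q N *_) (*-zeroʳ (qfac⁻¹ (+ a)))) (*-zeroʳ (poch q q N)))
  qbinomℤ-qfac⁻¹ -[1+ a ] K        N _ = sym (trans (cong (poch q q N *_) (*-zeroˡ (qfac⁻¹ K))) (*-zeroʳ (poch q q N)))

  qbinom-central : ∀ m t → qbinom q (2 ℕ.* m) (+ m ℤ.- t) ≡ poch q q (2 ℕ.* m) * (qfac⁻¹ (+ m ℤ.+ t) * qfac⁻¹ (+ m ℤ.- t))
  qbinom-central m t = trans (qbinomℤ-qfac⁻¹ (+ (2 ℕ.* m) ℤ.- (+ m ℤ.- t)) (+ m ℤ.- t) (2 ℕ.* m) (a-k+k≡a (+ (2 ℕ.* m)) (+ m ℤ.- t)))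
    (cong (λ a → poch q q (2 ℕ.* m) * (qfac⁻¹ a * qfac⁻¹ (+ m ℤ.- t))) (m+m-[m-t]≡m+t (+ m) t))
    where
    a-k+k≡a : ∀ a k → a ℤ.- k ℤ.+ k ≡ a
    a-k+k≡a = solve-∀
    m+m-[m-t]≡m+t : ∀ m t → m ℤ.+ (m ℤ.+ + 0) ℤ.- (m ℤ.- t) ≡ m ℤ.+ t
    m+m-[m-t]≡m+t = solve-∀

  X : ℕ → ℚ
  X n = q ^ n

  Z W : ℤ → ℚ
  Z j = q^ℤ (+ 3 ℤ.* j)
  W j = q^ℤ (ℤ.- (+ 3 ℤ.* j))

  ρ : ℕ → ℤ → Env
  ρ n j = env (vars q (X n) (Z j)) (vars q⁻¹ (inv (X n)) (W j))

  ρ-valid : ∀ n j → Valid (ρ n j)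
  ρ-valid n j varQ = q*q⁻¹≡1
  ρ-valid n j varX = inv-inverseʳ (q ^ n) (^-≢0 n q≢0)
  ρ-valid n j varZ = trans (cong (q^ℤ (+ 3 ℤ.* j) *_) (laurent-neg q q⁻¹ (+ 3 ℤ.* j))) (laurent-inverse q*q⁻¹≡1 (+ 3 ℤ.* j))

  ρ-suc : ∀ n j → ρ n (j ℤ.+ + 1) ≡ env (vars q (X n) (q ^ 3 * Z j)) (vars q⁻¹ (inv (X n)) (q⁻¹ ^ 3 * W j))
  ρ-suc n j = cong₂ (λ z w → env (vars q (X n) z) (vars q⁻¹ (inv (X n)) w))
    (trans (cong q^ℤ (3[j+1]≡3+3j j)) (q^ℤ-+ (+ 3) (+ 3 ℤ.* j)))
    (trans (cong q^ℤ (-3[j+1]≡-3-3j j)) (q^ℤ-+ (ℤ.- + 3) (ℤ.- (+ 3 ℤ.* j))))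
    where
    3[j+1]≡3+3j : ∀ j → + 3 ℤ.* (j ℤ.+ + 1) ≡ + 3 ℤ.+ + 3 ℤ.* j
    3[j+1]≡3+3j = solve-∀
    -3[j+1]≡-3-3j : ∀ j → ℤ.- (+ 3 ℤ.* (j ℤ.+ + 1)) ≡ ℤ.- + 3 ℤ.+ ℤ.- (+ 3 ℤ.* j)
    -3[j+1]≡-3-3j = solve-∀

  recCoeff : ℕ → ℕ → ℚ
  recCoeff i n = ⟦ recCoeffₑ i ⟧ (ρ n (+ 0))

  recCoeff-ρ : ∀ n j i → ⟦ recCoeffₑ i ⟧ (ρ n j) ≡ recCoeff i n
  recCoeff-ρ n j 0 = refl
  recCoeff-ρ n j 1 = refl
  recCoeff-ρ n j 2 = refl
  recCoeff-ρ n j 3 = refl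
  recCoeff-ρ n j 4 = refl
  recCoeff-ρ n j (suc (suc (suc (suc (suc _))))) = refl

  poch-2[n+i] : ∀ n i → poch q q (2 ℕ.* (n ℕ.+ i)) ≡ poch q q (2 ℕ.* n) * poch (q * X n ^ 2) q (2 ℕ.* i)
  poch-2[n+i] n i = begin
    poch q q (2 ℕ.* (n ℕ.+ i))                                  ≡⟨ cong (poch q q) (ℕP.*-distribˡ-+ 2 n i) ⟩
    poch q q (2 ℕ.* n ℕ.+ 2 ℕ.* i)                              ≡⟨ poch-+ q q (2 ℕ.* n) (2 ℕ.* i) ⟩
    poch q q (2 ℕ.* n) * poch (q * q ^ (2 ℕ.* n)) q (2 ℕ.* i)   ≡⟨ cong (λ x → poch q q (2 ℕ.* n) * poch (q * x) q (2 ℕ.* i)) q^2n≡X² ⟩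
    poch q q (2 ℕ.* n) * poch (q * X n ^ 2) q (2 ℕ.* i)         ∎
    where
    q^2n≡X² : q ^ (2 ℕ.* n) ≡ X n ^ 2
    q^2n≡X² = trans (cong (q ^_) (ℕP.*-comm 2 n)) (sym (^-*-assoc q n 2))

  q^[3∣j[j+1]∣] : ∀ j → q ^ (3 ℕ.* ℤ.∣ j ℤ.* (j ℤ.+ + 1) ∣) ≡ q^ℤ (+ 3 ℤ.* j ℤ.* (j ℤ.- + 1)) * (Z j * Z j)
  q^[3∣j[j+1]∣] j = begin
    q^ℤ (+ (3 ℕ.* ℤ.∣ j ℤ.* (j ℤ.+ + 1) ∣))        ≡⟨ cong q^ℤ (trans (ℤP.pos-* 3 ℤ.∣ j ℤ.* (j ℤ.+ + 1) ∣) (cong (+ 3 ℤ.*_) (+∣j[j+1]∣≡j[j+1] j))) ⟩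
    q^ℤ (+ 3 ℤ.* (j ℤ.* (j ℤ.+ + 1)))              ≡⟨ cong q^ℤ (split j) ⟩
    q^ℤ (t ℤ.* (j ℤ.- + 1) ℤ.+ (t ℤ.+ t))          ≡⟨ trans (q^ℤ-+ (t ℤ.* (j ℤ.- + 1)) (t ℤ.+ t)) (cong (q^ℤ (t ℤ.* (j ℤ.- + 1)) *_) (q^ℤ-+ t t)) ⟩
    q^ℤ (t ℤ.* (j ℤ.- + 1)) * (Z j * Z j)          ∎
    where
    t = + 3 ℤ.* j
    split : ∀ j → + 3 ℤ.* (j ℤ.* (j ℤ.+ + 1)) ≡ + 3 ℤ.* j ℤ.* (j ℤ.- + 1) ℤ.+ (+ 3 ℤ.* j ℤ.+ + 3 ℤ.* j)
    split = solve-∀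

  sgn-∣j+1∣ : ∀ j → sgn ℤ.∣ j ℤ.+ + 1 ∣ ≡ - sgn ℤ.∣ j ∣
  sgn-∣j+1∣ (+ k) rewrite ℕP.+-comm k 1 = refl
  sgn-∣j+1∣ -[1+ zero ]  = refl
  sgn-∣j+1∣ -[1+ suc k ] = solve 1 (λ s → s := :- (:- s)) refl (sgn (suc k))

  rhsBase : ℕ → ℤ → ℚ
  rhsBase n j = sgn ℤ.∣ j ∣ * q^ℤ (t ℤ.* (j ℤ.- + 1)) * poch q q (2 ℕ.* n) * qfac⁻¹ (+ (n ℕ.+ 4) ℤ.+ t) * qfac⁻¹ (+ (n ℕ.+ 4) ℤ.- t)
    where t = + 3 ℤ.* j

  rhsTerm-shift : ∀ n j i → i ≤ 4 → rhsTerm q (n ℕ.+ i) j ≡ rhsBase n j * ⟦ rhsShiftₑ i ⟧ (ρ n j)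
  rhsTerm-shift n j i i≤4 = begin
    s * q ^ (3 ℕ.* ℤ.∣ j ℤ.* (j ℤ.+ + 1) ∣) * qbinom q (2 ℕ.* (n ℕ.+ i)) (+ (n ℕ.+ i) ℤ.- t)
      ≡⟨ cong₂ (λ a b → s * a * b) (q^[3∣j[j+1]∣] j) (qbinom-central (n ℕ.+ i) t) ⟩
    s * (P * (Z j * Z j)) * (poch q q (2 ℕ.* (n ℕ.+ i)) * (qfac⁻¹ (+ (n ℕ.+ i) ℤ.+ t) * qfac⁻¹ (+ (n ℕ.+ i) ℤ.- t)))
      ≡⟨ congₙ 3 (λ a b c → s * (P * (Z j * Z j)) * (a * (b * c)))
           (poch-2[n+i] n i) (qfac⁻¹-lift n i 4 t i≤4) (qfac⁻¹-lift n i 4 (ℤ.- t) i≤4) ⟩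
    s * (P * (Z j * Z j)) * (p2n * A * ((fZ * iZ) * (fW * iW)))
      ≡⟨ solve 9 (λ s P Z p2n A fZ iZ fW iW → s :* (P :* (Z :* Z)) :* (p2n :* A :* ((fZ :* iZ) :* (fW :* iW)))
           := (s :* P :* p2n :* iZ :* iW) :* (Z :* (Z :* con 1ℚ) :* A :* fZ :* fW)) refl s P (Z j) p2n A fZ iZ fW iW ⟩
    rhsBase n j * (Z j ^ 2 * A * fZ * fW)
      ≡⟨ cong (rhsBase n j *_) (sym (congₙ 3 (λ a b c → Z j ^ 2 * a * b * c)
           (⟦pochₑ⟧ (qₑ ⊗ Xₑ ⊛ 2) qₑ (2 ℕ.* i) (ρ n j)) (⟦pochₑ⟧ (qₑ ⊛ suc i ⊗ Xₑ ⊗ Zₑ) qₑ (4 ℕ.∸ i) (ρ n j))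
           (⟦pochₑ⟧ (qₑ ⊛ suc i ⊗ Xₑ ⊗ Wₑ) qₑ (4 ℕ.∸ i) (ρ n j)))) ⟩
    rhsBase n j * ⟦ rhsShiftₑ i ⟧ (ρ n j)  ∎
    where
    t   = + 3 ℤ.* j
    s   = sgn ℤ.∣ j ∣
    P   = q^ℤ (t ℤ.* (j ℤ.- + 1))
    p2n = poch q q (2 ℕ.* n)
    A   = poch (q * X n ^ 2) q (2 ℕ.* i)
    fZ  = poch (q ^ suc i * X n * Z j) q (4 ℕ.∸ i)
    fW  = poch (q ^ suc i * X n * W j) q (4 ℕ.∸ i)
    iZ  = qfac⁻¹ (+ (n ℕ.+ 4) ℤ.+ t)
    iW  = qfac⁻¹ (+ (n ℕ.+ 4) ℤ.- t)

  rhsG : ℕ → ℤ → ℚ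
  rhsG n j = sgn ℤ.∣ j ∣ * q^ℤ (t ℤ.* (j ℤ.- + 1)) * poch q q (2 ℕ.* n) * qfac⁻¹ (+ (n ℕ.+ 4) ℤ.- t) * qfac⁻¹ (+ (n ℕ.+ 1) ℤ.+ t)
             * ⟦ rhsCertₑ Xₑ Zₑ Wₑ ⟧ (ρ n j)
    where t = + 3 ℤ.* j

  rhsG-base : ∀ n j → rhsG n j ≡ rhsBase n j * ⟦ pochₑ (qₑ ⊛ 2 ⊗ Xₑ ⊗ Zₑ) qₑ 3 ⊗ rhsCertₑ Xₑ Zₑ Wₑ ⟧ (ρ n j)
  rhsG-base n j = begin
    s * P * p2n * iW * qfac⁻¹ (+ (n ℕ.+ 1) ℤ.+ t) * C   ≡⟨ cong (λ a → s * P * p2n * iW * a * C) (qfac⁻¹-lift n 1 4 t (s≤s z≤n)) ⟩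
    s * P * p2n * iW * (f * iZ) * C                      ≡⟨ solve 7 (λ s P p2n iW f iZ C → s :* P :* p2n :* iW :* (f :* iZ) :* C
                                                              := (s :* P :* p2n :* iZ :* iW) :* (f :* C)) refl s P p2n iW f iZ C ⟩
    rhsBase n j * (f * C)                                ∎
    where
    t   = + 3 ℤ.* j
    s   = sgn ℤ.∣ j ∣
    P   = q^ℤ (t ℤ.* (j ℤ.- + 1))
    p2n = poch q q (2 ℕ.* n)
    iZ  = qfac⁻¹ (+ (n ℕ.+ 4) ℤ.+ t)
    iW  = qfac⁻¹ (+ (n ℕ.+ 4) ℤ.- t)
    f   = poch (q ^ 2 * X n * Z j) q 3
    C   = ⟦ rhsCertₑ Xₑ Zₑ Wₑ ⟧ (ρ n j)

  rhsG-suc : ∀ n j → rhsG n (j ℤ.+ + 1) ≡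
    - (rhsBase n j * ⟦ Zₑ ⊛ 2 ⊗ pochₑ (qₑ ⊛ 2 ⊗ Xₑ ⊗ Wₑ) qₑ 3 ⊗ rhsCertₑ Xₑ (qₑ ⊛ 3 ⊗ Zₑ) (q⁻¹ₑ ⊛ 3 ⊗ Wₑ) ⟧ (ρ n j))
  rhsG-suc n j = begin
    sgn ℤ.∣ j ℤ.+ + 1 ∣ * q^ℤ (t′ ℤ.* (j ℤ.+ + 1 ℤ.- + 1)) * p2n * qfac⁻¹ (+ (n ℕ.+ 4) ℤ.- t′) * qfac⁻¹ (+ (n ℕ.+ 1) ℤ.+ t′)
      * ⟦ rhsCertₑ Xₑ Zₑ Wₑ ⟧ (ρ n (j ℤ.+ + 1))
      ≡⟨ congₙ 5 (λ a b c d e → a * b * p2n * c * d * e) (sgn-∣j+1∣ j) power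
           (trans (cong qfac⁻¹ left) (qfac⁻¹-lift n 1 4 (ℤ.- t) (s≤s z≤n))) (cong qfac⁻¹ right)
           (cong ⟦ rhsCertₑ Xₑ Zₑ Wₑ ⟧ (ρ-suc n j)) ⟩
    - s * (P * (Z j * Z j)) * p2n * (f * iW) * iZ * C′
      ≡⟨ solve 8 (λ s P Z p2n f iW iZ C → :- s :* (P :* (Z :* Z)) :* p2n :* (f :* iW) :* iZ :* C
           := :- ((s :* P :* p2n :* iZ :* iW) :* (Z :* (Z :* con 1ℚ) :* f :* C))) refl s P (Z j) p2n f iW iZ C′ ⟩
    - (rhsBase n j * (Z j ^ 2 * f * C′))  ∎
    where
    t   = + 3 ℤ.* j
    t′  = + 3 ℤ.* (j ℤ.+ + 1)
    s   = sgn ℤ.∣ j ∣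
    P   = q^ℤ (t ℤ.* (j ℤ.- + 1))
    p2n = poch q q (2 ℕ.* n)
    iZ  = qfac⁻¹ (+ (n ℕ.+ 4) ℤ.+ t)
    iW  = qfac⁻¹ (+ (n ℕ.+ 4) ℤ.- t)
    f   = poch (q ^ 2 * X n * W j) q 3
    C′  = ⟦ rhsCertₑ Xₑ (qₑ ⊛ 3 ⊗ Zₑ) (q⁻¹ₑ ⊛ 3 ⊗ Wₑ) ⟧ (ρ n j)
    power : q^ℤ (t′ ℤ.* (j ℤ.+ + 1 ℤ.- + 1)) ≡ P * (Z j * Z j)
    power = trans (cong q^ℤ (split j)) (trans (q^ℤ-+ (t ℤ.* (j ℤ.- + 1)) (t ℤ.+ t)) (cong (P *_) (q^ℤ-+ t t)))
      where
      split : ∀ j → + 3 ℤ.* (j ℤ.+ + 1) ℤ.* (j ℤ.+ + 1 ℤ.- + 1) ≡ + 3 ℤ.* j ℤ.* (j ℤ.- + 1) ℤ.+ (+ 3 ℤ.* j ℤ.+ + 3 ℤ.* j)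
      split = solve-∀
    left : + (n ℕ.+ 4) ℤ.- t′ ≡ + (n ℕ.+ 1) ℤ.- t
    left = shift (+ n) j
      where
      shift : ∀ n j → n ℤ.+ + 4 ℤ.- + 3 ℤ.* (j ℤ.+ + 1) ≡ n ℤ.+ + 1 ℤ.- + 3 ℤ.* j
      shift = solve-∀
    right : + (n ℕ.+ 1) ℤ.+ t′ ≡ + (n ℕ.+ 4) ℤ.+ t
    right = shift (+ n) j
      where
      shift : ∀ n j → n ℤ.+ + 1 ℤ.+ + 3 ℤ.* (j ℤ.+ + 1) ≡ n ℤ.+ + 4 ℤ.+ + 3 ℤ.* j
      shift = solve-∀

  rhsTerm-telescopes : ∀ n j → sumTo 5 (λ i → recCoeff i n * rhsTerm q (n ℕ.+ i) j) ≡ rhsG n (j ℤ.+ + 1) - rhsG n j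
  rhsTerm-telescopes n j = trans (sumTo-cong 5 (λ i _ → cong (_* rhsTerm q (n ℕ.+ i) j) (sym (recCoeff-ρ n j i))))
    (telescoping-step {ρ n j} (ρ-valid n j) 5 recCoeffₑ rhsShiftₑ
      (pochₑ (qₑ ⊛ 2 ⊗ Xₑ ⊗ Zₑ) qₑ 3 ⊗ rhsCertₑ Xₑ Zₑ Wₑ)
      (Zₑ ⊛ 2 ⊗ pochₑ (qₑ ⊛ 2 ⊗ Xₑ ⊗ Wₑ) qₑ 3 ⊗ rhsCertₑ Xₑ (qₑ ⊛ 3 ⊗ Zₑ) (q⁻¹ₑ ⊛ 3 ⊗ Wₑ)) rhs-telescoping-identity
      (rhsBase n j) (rhsG n j) (rhsG n (j ℤ.+ + 1))
      (λ i → rhsTerm q (n ℕ.+ i) j) (λ i i<5 → rhsTerm-shift n j i (ℕP.≤-pred i<5)) (rhsG-base n j) (rhsG-suc n j))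

  rhsTerm-vanishes : ∀ m j → m < 3 ℕ.* ℤ.∣ j ∣ → rhsTerm q m j ≡ 0ℚ
  rhsTerm-vanishes m j m<3∣j∣ = begin
    s * e * qbinom q (2 ℕ.* m) (+ m ℤ.- t)                                   ≡⟨ cong (s * e *_) (qbinom-central m t) ⟩
    s * e * (poch q q (2 ℕ.* m) * (qfac⁻¹ (+ m ℤ.+ t) * qfac⁻¹ (+ m ℤ.- t)))  ≡⟨ cong (λ x → s * e * (poch q q (2 ℕ.* m) * x)) (one-factor-vanishes j m<3∣j∣) ⟩
    s * e * (poch q q (2 ℕ.* m) * 0ℚ)                                        ≡⟨ solve 3 (λ s e p → s :* e :* (p :* con 0ℚ) := con 0ℚ) refl s e (poch q q (2 ℕ.* m)) ⟩
    0ℚ                                                                       ∎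
    where
    t = + 3 ℤ.* j
    s = sgn ℤ.∣ j ∣
    e = q ^ (3 ℕ.* ℤ.∣ j ℤ.* (j ℤ.+ + 1) ∣)
    one-factor-vanishes : ∀ j → m < 3 ℕ.* ℤ.∣ j ∣ → qfac⁻¹ (+ m ℤ.+ + 3 ℤ.* j) * qfac⁻¹ (+ m ℤ.- + 3 ℤ.* j) ≡ 0ℚ
    one-factor-vanishes (+ k) m<3k = trans (cong (qfac⁻¹ (+ m ℤ.+ + 3 ℤ.* + k) *_)
      (trans (cong qfac⁻¹ (m-3j≡m⊖3j m k)) (qfac⁻¹-⊖ m (3 ℕ.* k) m<3k)))
      (*-zeroʳ (qfac⁻¹ (+ m ℤ.+ + 3 ℤ.* + k)))
    one-factor-vanishes -[1+ k ] m<3k = trans (cong (_* qfac⁻¹ (+ m ℤ.- + 3 ℤ.* -[1+ k ]))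
      (trans (cong qfac⁻¹ (ℤP.m-n≡m⊖n m (3 ℕ.* suc k))) (qfac⁻¹-⊖ m (3 ℕ.* suc k) m<3k)))
      (*-zeroˡ (qfac⁻¹ (+ m ℤ.- + 3 ℤ.* -[1+ k ])))

  rhsG-vanishes : ∀ n j → qfac⁻¹ (+ (n ℕ.+ 4) ℤ.- + 3 ℤ.* j) ≡ 0ℚ ⊎ qfac⁻¹ (+ (n ℕ.+ 1) ℤ.+ + 3 ℤ.* j) ≡ 0ℚ → rhsG n j ≡ 0ℚ
  rhsG-vanishes n j (inj₁ iW≡0) = trans (cong (λ x → s * P * p2n * x * iZ₁ * C) iW≡0)
    (solve 5 (λ s P p i C → s :* P :* p :* con 0ℚ :* i :* C := con 0ℚ) refl s P p2n iZ₁ C)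
    where s = sgn ℤ.∣ j ∣; P = q^ℤ (+ 3 ℤ.* j ℤ.* (j ℤ.- + 1)); p2n = poch q q (2 ℕ.* n)
          iZ₁ = qfac⁻¹ (+ (n ℕ.+ 1) ℤ.+ + 3 ℤ.* j); C = ⟦ rhsCertₑ Xₑ Zₑ Wₑ ⟧ (ρ n j)
  rhsG-vanishes n j (inj₂ iZ₁≡0) = trans (cong (λ x → s * P * p2n * iW * x * C) iZ₁≡0)
    (solve 5 (λ s P p i C → s :* P :* p :* i :* con 0ℚ :* C := con 0ℚ) refl s P p2n iW C)
    where s = sgn ℤ.∣ j ∣; P = q^ℤ (+ 3 ℤ.* j ℤ.* (j ℤ.- + 1)); p2n = poch q q (2 ℕ.* n)
          iW = qfac⁻¹ (+ (n ℕ.+ 4) ℤ.- + 3 ℤ.* j); C = ⟦ rhsCertₑ Xₑ Zₑ Wₑ ⟧ (ρ n j)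

  rhs-recurrence : ∀ n → sumTo 5 (λ i → recCoeff i n * rhs q (n ℕ.+ i)) ≡ 0ℚ
  rhs-recurrence n = begin
    sumTo 5 (λ i → recCoeff i n * rhs q (n ℕ.+ i))
      ≡⟨ sumTo-cong 5 (λ i i<5 → cong (recCoeff i n *_)
           (sym (window-vanishing (rhsTerm q (n ℕ.+ i)) (ℕP.+-monoʳ-≤ n (ℕP.≤-pred i<5))
             (λ k m<∣k∣ → rhsTerm-vanishes (n ℕ.+ i) k (ℕP.<-≤-trans m<∣k∣ (ℕP.m≤n*m ℤ.∣ k ∣ 3)))))) ⟩
    sumTo 5 (λ i → recCoeff i n * window (rhsTerm q (n ℕ.+ i)) M)
      ≡⟨ creative-telescoping 5 (suc (2 ℕ.* M)) (λ i → recCoeff i n) (λ i k → rhsTerm q (n ℕ.+ i) (+ k ℤ.- + M)) G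
           (λ k _ → trans (rhsTerm-telescopes n (+ k ℤ.- + M)) (cong (λ a → rhsG n a - G k) (index-suc k)))
           (rhsG-vanishes n (+ suc (2 ℕ.* M) ℤ.- + M) (inj₁ top)) (rhsG-vanishes n (+ 0 ℤ.- + M) (inj₂ bottom)) ⟩
    0ℚ ∎
    where
    M = n ℕ.+ 4
    G : ℕ → ℚ
    G k = rhsG n (+ k ℤ.- + M)
    index-suc : ∀ k → + k ℤ.- + M ℤ.+ + 1 ≡ + suc k ℤ.- + M
    index-suc k = shift (+ k) (+ M)
      where
      shift : ∀ k m → k ℤ.- m ℤ.+ + 1 ≡ + 1 ℤ.+ k ℤ.- m
      shift = solve-∀
    last-index : ∀ m → m ℤ.- + 3 ℤ.* (+ 1 ℤ.+ (m ℤ.+ (m ℤ.+ + 0)) ℤ.- m) ≡ m ℤ.- + 3 ℤ.* (m ℤ.+ + 1)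
    last-index = solve-∀
    first-index : ∀ a m → a ℤ.+ + 3 ℤ.* (+ 0 ℤ.- m) ≡ a ℤ.- + 3 ℤ.* m
    first-index = solve-∀
    top : qfac⁻¹ (+ M ℤ.- + 3 ℤ.* (+ suc (2 ℕ.* M) ℤ.- + M)) ≡ 0ℚ
    top = trans (cong qfac⁻¹ (trans (last-index (+ M)) (m-3j≡m⊖3j M (M ℕ.+ 1))))
                (qfac⁻¹-⊖ M (3 ℕ.* (M ℕ.+ 1)) (ℕP.<-≤-trans (ℕP.m<m+n M (s≤s z≤n)) (ℕP.m≤n*m (M ℕ.+ 1) 3)))
    bottom : qfac⁻¹ (+ (n ℕ.+ 1) ℤ.+ + 3 ℤ.* (+ 0 ℤ.- + M)) ≡ 0ℚ
    bottom = trans (cong qfac⁻¹ (trans (first-index (+ (n ℕ.+ 1)) (+ M)) (m-3j≡m⊖3j (n ℕ.+ 1) M)))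
                   (qfac⁻¹-⊖ (n ℕ.+ 1) (3 ℕ.* M) (ℕP.<-≤-trans (ℕP.+-monoʳ-< n (s≤s (s≤s z≤n))) (ℕP.m≤n*m M 3)))

  q³fac : ℕ → ℚ
  q³fac = poch (q ^ 3) (q ^ 3)

  q⁶fac⁻¹ : ℕ → ℚ
  q⁶fac⁻¹ j = inv (poch (q ^ 6) (q ^ 6) j)

  lhsNumerator : ℕ → ℕ → ℚ
  lhsNumerator m j = sgn j * q³fac (m ℕ.∸ j ℕ.∸ 1) * (1ℚ - q ^ (2 ℕ.* m)) * q ^ (3 ℕ.* j ℕ.* j ℕ.∸ 3 ℕ.* j)

  lhsTerm-qfac⁻¹ : ∀ m j → lhsTerm q m j ≡ lhsNumerator m j * (qfac⁻¹ (+ m ℤ.- + 3 ℤ.* + j) * q⁶fac⁻¹ j)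
  lhsTerm-qfac⁻¹ m j with 3 ℕ.* j ℕ.≤? m
  ... | yes 3j≤m = cong (lhsNumerator m j *_) (trans (inv-distrib-* (poch q q (m ℕ.∸ 3 ℕ.* j)) _)
    (cong (_* q⁶fac⁻¹ j) (sym (trans (cong qfac⁻¹ (m-3j≡m⊖3j m j)) (cong qfac⁻¹ (ℤP.⊖-≥ 3j≤m))))))
  ... | no 3j≰m = sym (begin
    lhsNumerator m j * (qfac⁻¹ (+ m ℤ.- + 3 ℤ.* + j) * q⁶fac⁻¹ j)  ≡⟨ cong (λ x → lhsNumerator m j * (x * q⁶fac⁻¹ j))
                                                                        (trans (cong qfac⁻¹ (m-3j≡m⊖3j m j)) (qfac⁻¹-⊖ m (3 ℕ.* j) (ℕP.≰⇒> 3j≰m))) ⟩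
    lhsNumerator m j * (0ℚ * q⁶fac⁻¹ j)                            ≡⟨ solve 2 (λ a b → a :* (con 0ℚ :* b) := con 0ℚ) refl (lhsNumerator m j) (q⁶fac⁻¹ j) ⟩
    0ℚ                                                             ∎)

  q⁶fac⁻¹-step : ∀ j → q⁶fac⁻¹ j ≡ (1ℚ - q ^ 6 * Z (+ j) ^ 2) * q⁶fac⁻¹ (suc j)
  q⁶fac⁻¹-step j = trans (inv[P]≡x*inv[P*x] (poch (q ^ 6) (q ^ 6) j) (1ℚ - q ^ 6 * (q ^ 6) ^ j) (1-q⁶⁽ʲ⁺¹⁾≢0 j))
    (cong (λ x → (1ℚ - q ^ 6 * x) * q⁶fac⁻¹ (suc j)) (q⁶ʲ≡Z² j))
    where
    6j≡3j*2 : ∀ j → 6 ℕ.* j ≡ 3 ℕ.* j ℕ.* 2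
    6j≡3j*2 = ℕ-Ring.solve-∀
    q⁶ʲ≡Z² : ∀ j → (q ^ 6) ^ j ≡ Z (+ j) ^ 2
    q⁶ʲ≡Z² j = begin
      (q ^ 6) ^ j          ≡⟨ ^-*-assoc q 6 j ⟩
      q ^ (6 ℕ.* j)        ≡⟨ cong (q ^_) (6j≡3j*2 j) ⟩
      q ^ (3 ℕ.* j ℕ.* 2)  ≡⟨ sym (^-*-assoc q (3 ℕ.* j) 2) ⟩
      (q ^ (3 ℕ.* j)) ^ 2  ≡⟨ cong (λ k → q^ℤ k ^ 2) (ℤP.pos-* 3 j) ⟩
      Z (+ j) ^ 2          ∎

  q³fac-split : ∀ n j i → j < n → q³fac (n ℕ.∸ j ℕ.∸ 1 ℕ.+ i) ≡ q³fac (n ℕ.∸ j ℕ.∸ 1) * poch (X n ^ 3 * W (+ j)) (q ^ 3) i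
  q³fac-split n j i j<n = trans (poch-+ (q ^ 3) (q ^ 3) (n ℕ.∸ j ℕ.∸ 1) i) (cong (λ a → q³fac (n ℕ.∸ j ℕ.∸ 1) * poch a (q ^ 3) i) q³⁽ⁿ⁻ʲ⁾≡X³W)
    where
    1+[n∸j∸1]≡n∸j : suc (n ℕ.∸ j ℕ.∸ 1) ≡ n ℕ.∸ j
    1+[n∸j∸1]≡n∸j = trans (ℕP.+-comm 1 _) (ℕP.m∸n+n≡m (ℕP.m<n⇒0<n∸m j<n))
    q³⁽ⁿ⁻ʲ⁾≡X³W : q ^ 3 * (q ^ 3) ^ (n ℕ.∸ j ℕ.∸ 1) ≡ X n ^ 3 * W (+ j)
    q³⁽ⁿ⁻ʲ⁾≡X³W = begin
      (q ^ 3) ^ suc (n ℕ.∸ j ℕ.∸ 1)        ≡⟨ cong ((q ^ 3) ^_) 1+[n∸j∸1]≡n∸j ⟩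
      (q ^ 3) ^ (n ℕ.∸ j)                  ≡⟨ ^-*-assoc q 3 (n ℕ.∸ j) ⟩
      q^ℤ (+ (3 ℕ.* (n ℕ.∸ j)))            ≡⟨ cong q^ℤ exponent ⟩
      q^ℤ (+ (n ℕ.* 3) ℤ.- + 3 ℤ.* + j)    ≡⟨ q^ℤ-+ (+ (n ℕ.* 3)) (ℤ.- (+ 3 ℤ.* + j)) ⟩
      q ^ (n ℕ.* 3) * W (+ j)              ≡⟨ cong (_* W (+ j)) (sym (^-*-assoc q n 3)) ⟩
      X n ^ 3 * W (+ j)                    ∎
      where
      distrib : ∀ n j → + 3 ℤ.* (n ℤ.- j) ≡ n ℤ.* + 3 ℤ.- + 3 ℤ.* j
      distrib = solve-∀
      exponent : + (3 ℕ.* (n ℕ.∸ j)) ≡ + (n ℕ.* 3) ℤ.- + 3 ℤ.* + j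
      exponent = begin
        + (3 ℕ.* (n ℕ.∸ j))          ≡⟨ ℤP.pos-* 3 (n ℕ.∸ j) ⟩
        + 3 ℤ.* + (n ℕ.∸ j)          ≡⟨ cong (+ 3 ℤ.*_) (trans (sym (ℤP.⊖-≥ (ℕP.<⇒≤ j<n))) (sym (ℤP.m-n≡m⊖n n j))) ⟩
        + 3 ℤ.* (+ n ℤ.- + j)        ≡⟨ distrib (+ n) (+ j) ⟩
        + n ℤ.* + 3 ℤ.- + 3 ℤ.* + j  ≡⟨ cong (ℤ._- + 3 ℤ.* + j) (sym (ℤP.pos-* n 3)) ⟩
        + (n ℕ.* 3) ℤ.- + 3 ℤ.* + j  ∎

  lhsBase : ℕ → ℕ → ℚ
  lhsBase n j = sgn j * q ^ (3 ℕ.* j ℕ.* j ℕ.∸ 3 ℕ.* j) * q³fac (n ℕ.∸ j ℕ.∸ 1) * qfac⁻¹ (+ (n ℕ.+ 4) ℤ.- + 3 ℤ.* + j) * q⁶fac⁻¹ (suc j)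

  lhsTerm-shift : ∀ n j i → j < n → i ≤ 4 → lhsTerm q (n ℕ.+ i) j ≡ lhsBase n j * ⟦ lhsShiftₑ i ⟧ (ρ n (+ j))
  lhsTerm-shift n j i j<n i≤4 = begin
    lhsTerm q (n ℕ.+ i) j
      ≡⟨ lhsTerm-qfac⁻¹ (n ℕ.+ i) j ⟩
    s * q³fac (n ℕ.+ i ℕ.∸ j ℕ.∸ 1) * (1ℚ - q ^ (2 ℕ.* (n ℕ.+ i))) * e * (qfac⁻¹ (+ (n ℕ.+ i) ℤ.- t) * q⁶fac⁻¹ j)
      ≡⟨ congₙ 4 (λ a b c d → s * a * (1ℚ - b) * e * (c * d)) split q²⁽ⁿ⁺ⁱ⁾≡q²ⁱX² (qfac⁻¹-lift n i 4 (ℤ.- t) i≤4) (q⁶fac⁻¹-step j) ⟩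
    s * (p3 * A3) * C * e * ((fW * iW) * (D * i6))
      ≡⟨ solve 9 (λ s p3 A3 C e fW iW D i6 → s :* (p3 :* A3) :* C :* e :* ((fW :* iW) :* (D :* i6))
           := (s :* e :* p3 :* iW :* i6) :* (C :* A3 :* fW :* D)) refl s p3 A3 C e fW iW D i6 ⟩
    lhsBase n j * (C * A3 * fW * D)
      ≡⟨ cong (lhsBase n j *_) (sym (cong₂ (λ a b → C * a * b * D)
           (⟦pochₑ⟧ (Xₑ ⊛ 3 ⊗ Wₑ) (qₑ ⊛ 3) i (ρ n (+ j))) (⟦pochₑ⟧ (qₑ ⊛ suc i ⊗ Xₑ ⊗ Wₑ) qₑ (4 ℕ.∸ i) (ρ n (+ j))))) ⟩
    lhsBase n j * ⟦ lhsShiftₑ i ⟧ (ρ n (+ j))  ∎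
    where
    t  = + 3 ℤ.* + j
    s  = sgn j
    e  = q ^ (3 ℕ.* j ℕ.* j ℕ.∸ 3 ℕ.* j)
    p3 = q³fac (n ℕ.∸ j ℕ.∸ 1)
    A3 = poch (X n ^ 3 * W (+ j)) (q ^ 3) i
    C  = 1ℚ - q ^ (2 ℕ.* i) * X n ^ 2
    fW = poch (q ^ suc i * X n * W (+ j)) q (4 ℕ.∸ i)
    iW = qfac⁻¹ (+ (n ℕ.+ 4) ℤ.- t)
    D  = 1ℚ - q ^ 6 * Z (+ j) ^ 2
    i6 = q⁶fac⁻¹ (suc j)
    split : q³fac (n ℕ.+ i ℕ.∸ j ℕ.∸ 1) ≡ p3 * A3
    split = trans (cong q³fac (trans (cong (ℕ._∸ 1) (ℕP.+-∸-comm i (ℕP.<⇒≤ j<n))) (ℕP.+-∸-comm i (ℕP.m<n⇒0<n∸m j<n))))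
                  (q³fac-split n j i j<n)
    distrib : ∀ n i → 2 ℕ.* (n ℕ.+ i) ≡ 2 ℕ.* i ℕ.+ n ℕ.* 2
    distrib = ℕ-Ring.solve-∀
    q²⁽ⁿ⁺ⁱ⁾≡q²ⁱX² : q ^ (2 ℕ.* (n ℕ.+ i)) ≡ q ^ (2 ℕ.* i) * X n ^ 2
    q²⁽ⁿ⁺ⁱ⁾≡q²ⁱX² = begin
      q ^ (2 ℕ.* (n ℕ.+ i))          ≡⟨ cong (q ^_) (distrib n i) ⟩
      q ^ (2 ℕ.* i ℕ.+ n ℕ.* 2)      ≡⟨ ^-distribˡ-+-* q (2 ℕ.* i) (n ℕ.* 2) ⟩
      q ^ (2 ℕ.* i) * q ^ (n ℕ.* 2)  ≡⟨ cong (q ^ (2 ℕ.* i) *_) (sym (^-*-assoc q n 2)) ⟩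
      q ^ (2 ℕ.* i) * X n ^ 2        ∎

  lhsG : ℕ → ℕ → ℚ
  lhsG n j = sgn j * q ^ (3 ℕ.* j ℕ.* j ℕ.∸ 3 ℕ.* j) * q³fac (n ℕ.∸ j) * qfac⁻¹ (+ (n ℕ.+ 4) ℤ.- + 3 ℤ.* + j) * q⁶fac⁻¹ j
             * ⟦ lhsCertₑ Xₑ Zₑ Wₑ ⟧ (ρ n (+ j))

  lhsG-base : ∀ n j → j < n →
    lhsG n j ≡ lhsBase n j * ⟦ pochₑ (Xₑ ⊛ 3 ⊗ Wₑ) (qₑ ⊛ 3) 1 ⊗ (one ⊖ qₑ ⊛ 6 ⊗ Zₑ ⊛ 2) ⊗ lhsCertₑ Xₑ Zₑ Wₑ ⟧ (ρ n (+ j))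
  lhsG-base n j j<n = begin
    s * e * q³fac (n ℕ.∸ j) * iW * q⁶fac⁻¹ j * C   ≡⟨ cong₂ (λ a b → s * e * a * iW * b * C)
                                                       (trans (cong q³fac n∸j≡[n∸j∸1]+1) (q³fac-split n j 1 j<n)) (q⁶fac⁻¹-step j) ⟩
    s * e * (p3 * A1) * iW * (D * i6) * C           ≡⟨ solve 8 (λ s e p3 A1 iW D i6 C → s :* e :* (p3 :* A1) :* iW :* (D :* i6) :* C
                                                         := (s :* e :* p3 :* iW :* i6) :* (A1 :* D :* C)) refl s e p3 A1 iW D i6 C ⟩
    lhsBase n j * (A1 * D * C)                      ∎
    where
    s  = sgn j
    e  = q ^ (3 ℕ.* j ℕ.* j ℕ.∸ 3 ℕ.* j)
    p3 = q³fac (n ℕ.∸ j ℕ.∸ 1)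
    A1 = poch (X n ^ 3 * W (+ j)) (q ^ 3) 1
    iW = qfac⁻¹ (+ (n ℕ.+ 4) ℤ.- + 3 ℤ.* + j)
    D  = 1ℚ - q ^ 6 * Z (+ j) ^ 2
    i6 = q⁶fac⁻¹ (suc j)
    C  = ⟦ lhsCertₑ Xₑ Zₑ Wₑ ⟧ (ρ n (+ j))
    n∸j≡[n∸j∸1]+1 : n ℕ.∸ j ≡ n ℕ.∸ j ℕ.∸ 1 ℕ.+ 1
    n∸j≡[n∸j∸1]+1 = sym (ℕP.m∸n+n≡m (ℕP.m<n⇒0<n∸m j<n))

  q^[3j²∸3j]-suc : ∀ j → q ^ (3 ℕ.* suc j ℕ.* suc j ℕ.∸ 3 ℕ.* suc j) ≡ q ^ (3 ℕ.* j ℕ.* j ℕ.∸ 3 ℕ.* j) * (Z (+ j) * Z (+ j))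
  q^[3j²∸3j]-suc j = begin
    q ^ (3 ℕ.* suc j ℕ.* suc j ℕ.∸ 3 ℕ.* suc j)                   ≡⟨ cong (q ^_) (exponent j) ⟩
    q ^ (3 ℕ.* j ℕ.* j ℕ.∸ 3 ℕ.* j ℕ.+ (3 ℕ.* j ℕ.+ 3 ℕ.* j))      ≡⟨ trans (^-distribˡ-+-* q (3 ℕ.* j ℕ.* j ℕ.∸ 3 ℕ.* j) (3 ℕ.* j ℕ.+ 3 ℕ.* j))
                                                                       (cong (q ^ (3 ℕ.* j ℕ.* j ℕ.∸ 3 ℕ.* j) *_) (^-distribˡ-+-* q (3 ℕ.* j) (3 ℕ.* j))) ⟩
    q ^ (3 ℕ.* j ℕ.* j ℕ.∸ 3 ℕ.* j) * (q ^ (3 ℕ.* j) * q ^ (3 ℕ.* j))  ≡⟨ cong (λ z → q ^ (3 ℕ.* j ℕ.* j ℕ.∸ 3 ℕ.* j) * (z * z)) (cong q^ℤ (ℤP.pos-* 3 j)) ⟩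
    q ^ (3 ℕ.* j ℕ.* j ℕ.∸ 3 ℕ.* j) * (Z (+ j) * Z (+ j))             ∎
    where
    expand : ∀ k → 3 ℕ.* (2 ℕ.+ k) ℕ.* (1 ℕ.+ k) ≡ 3 ℕ.* (1 ℕ.+ k) ℕ.* k ℕ.+ (3 ℕ.* (1 ℕ.+ k) ℕ.+ 3 ℕ.* (1 ℕ.+ k))
    expand = ℕ-Ring.solve-∀
    exponent : ∀ j → 3 ℕ.* suc j ℕ.* suc j ℕ.∸ 3 ℕ.* suc j ≡ 3 ℕ.* j ℕ.* j ℕ.∸ 3 ℕ.* j ℕ.+ (3 ℕ.* j ℕ.+ 3 ℕ.* j)
    exponent zero    = refl
    exponent (suc k) = begin
      3 ℕ.* (2 ℕ.+ k) ℕ.* (2 ℕ.+ k) ℕ.∸ 3 ℕ.* (2 ℕ.+ k)              ≡⟨ 3[1+m]²∸3[1+m]≡3[1+m]m (suc k) ⟩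
      3 ℕ.* (2 ℕ.+ k) ℕ.* (1 ℕ.+ k)                                  ≡⟨ expand k ⟩
      3 ℕ.* (1 ℕ.+ k) ℕ.* k ℕ.+ (3 ℕ.* (1 ℕ.+ k) ℕ.+ 3 ℕ.* (1 ℕ.+ k))  ≡⟨ cong (ℕ._+ (3 ℕ.* (1 ℕ.+ k) ℕ.+ 3 ℕ.* (1 ℕ.+ k))) (sym (3[1+m]²∸3[1+m]≡3[1+m]m k)) ⟩
      3 ℕ.* suc k ℕ.* suc k ℕ.∸ 3 ℕ.* suc k ℕ.+ (3 ℕ.* suc k ℕ.+ 3 ℕ.* suc k)  ∎

  lhsG-suc : ∀ n j → j < n →
    lhsG n (suc j) ≡ - (lhsBase n j * ⟦ Zₑ ⊛ 2 ⊗ pochₑ (qₑ ⊛ 2 ⊗ Xₑ ⊗ Wₑ) qₑ 3 ⊗ lhsCertₑ Xₑ (qₑ ⊛ 3 ⊗ Zₑ) (q⁻¹ₑ ⊛ 3 ⊗ Wₑ) ⟧ (ρ n (+ j)))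
  lhsG-suc n j j<n = begin
    - s * q ^ (3 ℕ.* suc j ℕ.* suc j ℕ.∸ 3 ℕ.* suc j) * q³fac (n ℕ.∸ suc j) * qfac⁻¹ (+ (n ℕ.+ 4) ℤ.- + 3 ℤ.* + suc j) * i6
      * ⟦ lhsCertₑ Xₑ Zₑ Wₑ ⟧ (ρ n (+ suc j))
      ≡⟨ congₙ 4 (λ a b c d → - s * a * b * c * i6 * d) (q^[3j²∸3j]-suc j) (cong q³fac (sym (trans (ℕP.∸-+-assoc n j 1) (cong (n ℕ.∸_) (ℕP.+-comm j 1)))))
           (trans (cong qfac⁻¹ left) (qfac⁻¹-lift n 1 4 (ℤ.- t) (s≤s z≤n)))
           (trans (cong (λ k → ⟦ lhsCertₑ Xₑ Zₑ Wₑ ⟧ (ρ n (+ k))) (ℕP.+-comm 1 j)) (cong ⟦ lhsCertₑ Xₑ Zₑ Wₑ ⟧ (ρ-suc n (+ j)))) ⟩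
    - s * (e * (Z (+ j) * Z (+ j))) * p3 * (f * iW) * i6 * C′
      ≡⟨ solve 8 (λ s e Z p3 f iW i6 C → :- s :* (e :* (Z :* Z)) :* p3 :* (f :* iW) :* i6 :* C
           := :- ((s :* e :* p3 :* iW :* i6) :* (Z :* (Z :* con 1ℚ) :* f :* C))) refl s e (Z (+ j)) p3 f iW i6 C′ ⟩
    - (lhsBase n j * (Z (+ j) ^ 2 * f * C′))  ∎
    where
    t  = + 3 ℤ.* + j
    s  = sgn j
    e  = q ^ (3 ℕ.* j ℕ.* j ℕ.∸ 3 ℕ.* j)
    p3 = q³fac (n ℕ.∸ j ℕ.∸ 1)
    f  = poch (q ^ 2 * X n * W (+ j)) q 3
    iW = qfac⁻¹ (+ (n ℕ.+ 4) ℤ.- t)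
    i6 = q⁶fac⁻¹ (suc j)
    C′ = ⟦ lhsCertₑ Xₑ (qₑ ⊛ 3 ⊗ Zₑ) (q⁻¹ₑ ⊛ 3 ⊗ Wₑ) ⟧ (ρ n (+ j))
    left : + (n ℕ.+ 4) ℤ.- + 3 ℤ.* + suc j ≡ + (n ℕ.+ 1) ℤ.- t
    left = shift (+ n) (+ j)
      where
      shift : ∀ n j → n ℤ.+ + 4 ℤ.- + 3 ℤ.* (+ 1 ℤ.+ j) ≡ n ℤ.+ + 1 ℤ.- + 3 ℤ.* j
      shift = solve-∀

  lhsTerm-telescopes-j<n : ∀ n j → j < n → sumTo 5 (λ i → recCoeff i n * lhsTerm q (n ℕ.+ i) j) ≡ lhsG n (suc j) - lhsG n j
  lhsTerm-telescopes-j<n n j j<n = trans (sumTo-cong 5 (λ i _ → cong (_* lhsTerm q (n ℕ.+ i) j) (sym (recCoeff-ρ n (+ j) i))))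
    (telescoping-step {ρ n (+ j)} (ρ-valid n (+ j)) 5 recCoeffₑ lhsShiftₑ
      (pochₑ (Xₑ ⊛ 3 ⊗ Wₑ) (qₑ ⊛ 3) 1 ⊗ (one ⊖ qₑ ⊛ 6 ⊗ Zₑ ⊛ 2) ⊗ lhsCertₑ Xₑ Zₑ Wₑ)
      (Zₑ ⊛ 2 ⊗ pochₑ (qₑ ⊛ 2 ⊗ Xₑ ⊗ Wₑ) qₑ 3 ⊗ lhsCertₑ Xₑ (qₑ ⊛ 3 ⊗ Zₑ) (q⁻¹ₑ ⊛ 3 ⊗ Wₑ)) lhs-telescoping-identity
      (lhsBase n j) (lhsG n j) (lhsG n (suc j)) (λ i → lhsTerm q (n ℕ.+ i) j)
      (λ i i<5 → lhsTerm-shift n j i j<n (ℕP.≤-pred i<5)) (lhsG-base n j j<n) (lhsG-suc n j j<n))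

  lhsTerm-vanishes : ∀ m j → m < 3 ℕ.* j → lhsTerm q m j ≡ 0ℚ
  lhsTerm-vanishes m j m<3j with 3 ℕ.* j ℕ.≤? m
  ... | yes 3j≤m = ⊥-elim (ℕP.<⇒≱ m<3j 3j≤m)
  ... | no  _    = refl

  lhsG-vanishes : ∀ n j → n ℕ.+ 4 < 3 ℕ.* j → lhsG n j ≡ 0ℚ
  lhsG-vanishes n j n+4<3j = trans (cong (λ x → s * e * p3 * x * i6 * C) (trans (cong qfac⁻¹ (m-3j≡m⊖3j (n ℕ.+ 4) j)) (qfac⁻¹-⊖ _ _ n+4<3j)))
    (solve 5 (λ s e p i C → s :* e :* p :* con 0ℚ :* i :* C := con 0ℚ) refl s e p3 i6 C)
    where s = sgn j; e = q ^ (3 ℕ.* j ℕ.* j ℕ.∸ 3 ℕ.* j); p3 = q³fac (n ℕ.∸ j); i6 = q⁶fac⁻¹ j; C = ⟦ lhsCertₑ Xₑ Zₑ Wₑ ⟧ (ρ n (+ j))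

  lhsTerm-telescopes-far : ∀ n j → n ℕ.+ 4 < 3 ℕ.* j → sumTo 5 (λ i → recCoeff i n * lhsTerm q (n ℕ.+ i) j) ≡ lhsG n (suc j) - lhsG n j
  lhsTerm-telescopes-far n j n+4<3j = begin
    sumTo 5 (λ i → recCoeff i n * lhsTerm q (n ℕ.+ i) j)  ≡⟨ sumTo-cong 5 (λ i i<5 → trans (cong (recCoeff i n *_)
                                                               (lhsTerm-vanishes (n ℕ.+ i) j (ℕP.≤-<-trans (ℕP.+-monoʳ-≤ n (ℕP.≤-pred i<5)) n+4<3j)))
                                                               (*-zeroʳ (recCoeff i n))) ⟩
    sumTo 5 (λ _ → 0ℚ)                                    ≡⟨⟩
    0ℚ - 0ℚ                                               ≡⟨ cong₂ _-_ (sym (lhsG-vanishes n (suc j) (ℕP.<-≤-trans n+4<3j (ℕP.*-monoʳ-≤ 3 (ℕP.n≤1+n j)))))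
                                                               (sym (lhsG-vanishes n j n+4<3j)) ⟩
    lhsG n (suc j) - lhsG n j                             ∎

  -- For n ≥ 3 every j ≥ n has 3j > n + 4, so the truncated subtraction in (q³;q³)ₙ₋ⱼ₋₁ never matters.
  lhsTerm-telescopes : ∀ n j → 3 ≤ n → sumTo 5 (λ i → recCoeff i n * lhsTerm q (n ℕ.+ i) j) ≡ lhsG n (suc j) - lhsG n j
  lhsTerm-telescopes n j 3≤n with j ℕ.<? n
  ... | yes j<n = lhsTerm-telescopes-j<n n j j<n
  ... | no  j≮n = lhsTerm-telescopes-far n j (ℕP.<-≤-trans (ℕP.+-monoʳ-< n 4<2n) (ℕP.≤-trans (ℕP.≤-reflexive (n+2n≡3n n)) (ℕP.*-monoʳ-≤ 3 (ℕP.≮⇒≥ j≮n))))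
    where
    4<2n : 4 < 2 ℕ.* n
    4<2n = ℕP.<-≤-trans (s≤s (s≤s (s≤s (s≤s (s≤s z≤n))))) (ℕP.*-monoʳ-≤ 2 3≤n)
    n+2n≡3n : ∀ n → n ℕ.+ 2 ℕ.* n ≡ 3 ℕ.* n
    n+2n≡3n = ℕ-Ring.solve-∀

  lhs-recurrence : ∀ n → 3 ≤ n → sumTo 5 (λ i → recCoeff i n * lhs q (n ℕ.+ i)) ≡ 0ℚ
  lhs-recurrence n 3≤n = begin
    sumTo 5 (λ i → recCoeff i n * lhs q (n ℕ.+ i))
      ≡⟨ sumTo-cong 5 (λ i i<5 → cong (recCoeff i n *_) (sym (sumTo-vanishing-tail (lhsTerm q (n ℕ.+ i))
           (s≤s (ℕP.+-monoʳ-≤ n (ℕP.≤-pred i<5))) (λ j m<j → lhsTerm-vanishes (n ℕ.+ i) j (ℕP.<-≤-trans m<j (ℕP.m≤n*m j 3)))))) ⟩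
    sumTo 5 (λ i → recCoeff i n * sumTo K (lhsTerm q (n ℕ.+ i)))
      ≡⟨ creative-telescoping 5 K (λ i → recCoeff i n) (λ i → lhsTerm q (n ℕ.+ i)) (lhsG n) (λ j _ → lhsTerm-telescopes n j 3≤n)
           (lhsG-vanishes n K (ℕP.<-≤-trans (ℕP.n<1+n (n ℕ.+ 4)) (ℕP.m≤n*m K 3))) G[0]≡0 ⟩
    0ℚ ∎
    where
    K = suc (n ℕ.+ 4)
    G[0]≡0 : lhsG n 0 ≡ 0ℚ
    G[0]≡0 = trans (cong (lhsG′ *_) (norm≡[]⇒⟦⟧≡0 {ρ n (+ 0)} (ρ-valid n (+ 0)) (lhsCertₑ Xₑ one one) lhsCert-at-Z=1)) (*-zeroʳ lhsG′)
      where lhsG′ = sgn 0 * q ^ 0 * q³fac n * qfac⁻¹ (+ (n ℕ.+ 4) ℤ.- + 3 ℤ.* + 0) * q⁶fac⁻¹ 0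

  denominator : ℕ → ℚ
  denominator n = poch q q (2 ℕ.* n) * poch (q ^ 6) (q ^ 6) 2

  ρ₀ : Env
  ρ₀ = ρ 0 (+ 0)

  lhsTerm-cleared : ∀ n j → n ≤ 8 → denominator n * lhsTerm q n j ≡ ⟦ lhsClearedₑ n j ⟧ ρ₀
  lhsTerm-cleared n j n≤8 with 3 ℕ.* j ℕ.≤? n
  ... | no  _    = *-zeroʳ (denominator n)
  ... | yes 3j≤n = trans (begin
    p2n * p6 * (A * inv (P1 * P2))               ≡⟨ cong (λ x → p2n * p6 * (A * x)) (inv-distrib-* P1 P2) ⟩
    p2n * p6 * (A * (inv P1 * inv P2))           ≡⟨ solve 5 (λ a b A c d → a :* b :* (A :* (c :* d)) := A :* (a :* c) :* (b :* d))
                                                      refl p2n p6 A (inv P1) (inv P2) ⟩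
    A * (p2n * inv P1) * (p6 * inv P2)           ≡⟨ cong₂ (λ x y → A * x * y)
                                                      (trans (cong (λ k → poch q q k * inv P1) (sym (ℕP.m+[n∸m]≡n N≤2n))) (poch-+-inv q q N _ (poch-q-≢0 N)))
                                                      (trans (cong (λ k → poch (q ^ 6) (q ^ 6) k * inv P2) (sym (ℕP.m+[n∸m]≡n j≤2)))
                                                             (poch-+-inv (q ^ 6) (q ^ 6) j _ (poch-q⁶-≢0 j))) ⟩
    A * poch (q * q ^ N) q (2 ℕ.* n ℕ.∸ N) * poch (q ^ 6 * (q ^ 6) ^ j) (q ^ 6) (2 ℕ.∸ j)  ∎)
    (sym (congₙ 4 (λ a b c d → a * b * (1ℚ - q ^ (2 ℕ.* n)) * q ^ (3 ℕ.* j ℕ.* j ℕ.∸ 3 ℕ.* j) * c * d)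
           (⟦sgnₑ⟧ j ρ₀) (⟦pochₑ⟧ (qₑ ⊛ 3) (qₑ ⊛ 3) (n ℕ.∸ j ℕ.∸ 1) ρ₀)
           (⟦pochₑ⟧ (qₑ ⊗ qₑ ⊛ N) qₑ (2 ℕ.* n ℕ.∸ N) ρ₀) (⟦pochₑ⟧ (qₑ ⊛ 6 ⊗ (qₑ ⊛ 6) ⊛ j) (qₑ ⊛ 6) (2 ℕ.∸ j) ρ₀)))
    where
    N   = n ℕ.∸ 3 ℕ.* j
    p2n = poch q q (2 ℕ.* n)
    p6  = poch (q ^ 6) (q ^ 6) 2
    A   = lhsNumerator n j
    P1  = poch q q N
    P2  = poch (q ^ 6) (q ^ 6) j
    N≤2n : N ≤ 2 ℕ.* n
    N≤2n = ℕP.≤-trans (ℕP.m∸n≤m n (3 ℕ.* j)) (ℕP.m≤m+n n (n ℕ.+ 0))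
    j≤2 : j ≤ 2
    j≤2 = ℕP.≤-pred (ℕP.*-cancelˡ-< 3 j 3 (s≤s (ℕP.≤-trans 3j≤n n≤8)))

  qfac⁻¹-pair : ∀ n j → 3 ℕ.* ℤ.∣ j ∣ ≤ n →
    qfac⁻¹ (+ n ℤ.+ + 3 ℤ.* j) * qfac⁻¹ (+ n ℤ.- + 3 ℤ.* j) ≡ inv (poch q q (n ℕ.+ 3 ℕ.* ℤ.∣ j ∣)) * inv (poch q q (n ℕ.∸ 3 ℕ.* ℤ.∣ j ∣))
  qfac⁻¹-pair n (+ k) 3k≤n = cong₂ _*_ (cong (λ a → qfac⁻¹ (+ n ℤ.+ a)) (sym (ℤP.pos-* 3 k)))
    (trans (cong qfac⁻¹ (m-3j≡m⊖3j n k)) (cong qfac⁻¹ (ℤP.⊖-≥ 3k≤n)))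
  qfac⁻¹-pair n -[1+ k ] 3k≤n = trans (*-comm (qfac⁻¹ (+ n ℤ.+ + 3 ℤ.* -[1+ k ])) (qfac⁻¹ (+ n ℤ.- + 3 ℤ.* -[1+ k ])))
    (cong (inv (poch q q (n ℕ.+ 3 ℕ.* suc k)) *_) (trans (cong qfac⁻¹ (ℤP.m-n≡m⊖n n (3 ℕ.* suc k))) (cong qfac⁻¹ (ℤP.⊖-≥ 3k≤n))))

  rhsTerm-cleared : ∀ n j → denominator n * rhsTerm q n j ≡ ⟦ rhsClearedₑ n j ⟧ ρ₀
  rhsTerm-cleared n j with 3 ℕ.* ℤ.∣ j ∣ ℕ.≤? n
  ... | no 3m≰n  = trans (cong (denominator n *_) (rhsTerm-vanishes n j (ℕP.≰⇒> 3m≰n))) (*-zeroʳ (denominator n))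
  ... | yes 3m≤n = trans (begin
    p2n * p6 * (s * e * qbinom q (2 ℕ.* n) (+ n ℤ.- t))    ≡⟨ cong (λ x → p2n * p6 * (s * e * x))
                                                                (trans (qbinom-central n t) (cong (p2n *_) (qfac⁻¹-pair n j 3m≤n))) ⟩
    p2n * p6 * (s * e * (p2n * (inv Pa * inv Pb)))          ≡⟨ solve 6 (λ p p6 s e a b → p :* p6 :* (s :* e :* (p :* (a :* b)))
                                                                  := s :* e :* (p :* a) :* (p :* b) :* p6) refl p2n p6 s e (inv Pa) (inv Pb) ⟩
    s * e * (p2n * inv Pa) * (p2n * inv Pb) * p6            ≡⟨ cong₂ (λ x y → s * e * x * y * p6)
                                                                (trans (cong (λ k → poch q q k * inv Pa) (sym a+b≡2n)) (poch-+-inv q q a b (poch-q-≢0 a)))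
                                                                (trans (cong (λ k → poch q q k * inv Pb) (sym (trans (ℕP.+-comm b a) a+b≡2n))) (poch-+-inv q q b a (poch-q-≢0 b))) ⟩
    s * e * poch (q * q ^ a) q b * poch (q * q ^ b) q a * p6  ∎)
    (sym (congₙ 3 (λ x y z → x * e * y * z * p6) (⟦sgnₑ⟧ ℤ.∣ j ∣ ρ₀) (⟦pochₑ⟧ (qₑ ⊗ qₑ ⊛ a) qₑ b ρ₀) (⟦pochₑ⟧ (qₑ ⊗ qₑ ⊛ b) qₑ a ρ₀)))
    where
    t   = + 3 ℤ.* j
    m   = ℤ.∣ j ∣
    a   = n ℕ.+ 3 ℕ.* m
    b   = n ℕ.∸ 3 ℕ.* m
    s   = sgn m
    e   = q ^ (3 ℕ.* ℤ.∣ j ℤ.* (j ℤ.+ + 1) ∣)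
    p2n = poch q q (2 ℕ.* n)
    p6  = poch (q ^ 6) (q ^ 6) 2
    Pa  = poch q q a
    Pb  = poch q q b
    a+b≡2n : a ℕ.+ b ≡ 2 ℕ.* n
    a+b≡2n = begin
      n ℕ.+ 3 ℕ.* m ℕ.+ (n ℕ.∸ 3 ℕ.* m)    ≡⟨ ℕP.+-assoc n (3 ℕ.* m) b ⟩
      n ℕ.+ (3 ℕ.* m ℕ.+ (n ℕ.∸ 3 ℕ.* m))  ≡⟨ cong (n ℕ.+_) (ℕP.m+[n∸m]≡n 3m≤n) ⟩
      n ℕ.+ n                              ≡⟨ cong (n ℕ.+_) (sym (ℕP.+-identityʳ n)) ⟩
      2 ℕ.* n                              ∎

  lhs-cleared : ∀ n → n ≤ 8 → denominator n * lhs q n ≡ ⟦ sumₑ (suc n) (lhsClearedₑ n) ⟧ ρ₀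
  lhs-cleared n n≤8 = begin
    denominator n * lhs q n                               ≡⟨ *-distribˡ-sumTo (suc n) (denominator n) (lhsTerm q n) ⟩
    sumTo (suc n) (λ j → denominator n * lhsTerm q n j)   ≡⟨ sumTo-cong (suc n) (λ j _ → lhsTerm-cleared n j n≤8) ⟩
    sumTo (suc n) (λ j → ⟦ lhsClearedₑ n j ⟧ ρ₀)          ≡⟨ sym (⟦sumₑ⟧ (suc n) (lhsClearedₑ n) ρ₀) ⟩
    ⟦ sumₑ (suc n) (lhsClearedₑ n) ⟧ ρ₀                   ∎

  rhs-cleared : ∀ n → denominator n * rhs q n ≡ ⟦ sumₑ (suc (2 ℕ.* n)) (λ i → rhsClearedₑ n (+ i ℤ.- + n)) ⟧ ρ₀
  rhs-cleared n = begin
    denominator n * rhs q n                                           ≡⟨ *-distribˡ-sumTo (suc (2 ℕ.* n)) (denominator n) _ ⟩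
    sumTo (suc (2 ℕ.* n)) (λ i → denominator n * rhsTerm q n (+ i ℤ.- + n))  ≡⟨ sumTo-cong (suc (2 ℕ.* n)) (λ i _ → rhsTerm-cleared n (+ i ℤ.- + n)) ⟩
    sumTo (suc (2 ℕ.* n)) (λ i → ⟦ rhsClearedₑ n (+ i ℤ.- + n) ⟧ ρ₀)  ≡⟨ sym (⟦sumₑ⟧ (suc (2 ℕ.* n)) (λ i → rhsClearedₑ n (+ i ℤ.- + n)) ρ₀) ⟩
    ⟦ sumₑ (suc (2 ℕ.* n)) (λ i → rhsClearedₑ n (+ i ℤ.- + n)) ⟧ ρ₀   ∎

  lhs≡rhs-initial : ∀ n → 1 ≤ n → n ≤ 6 → lhs q n ≡ rhs q n
  lhs≡rhs-initial n 1≤n n≤6 = *-cancelˡ-≢0 (x#0y#0→xy#0 (poch-q-≢0 (2 ℕ.* n)) (poch-q⁶-≢0 2)) (begin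
    denominator n * lhs q n                         ≡⟨ lhs-cleared n (ℕP.≤-trans n≤6 (ℕP.m≤m+n 6 2)) ⟩
    ⟦ sumₑ (suc n) (lhsClearedₑ n) ⟧ ρ₀             ≡⟨ x-y≡0⇒x≡y (norm≡[]⇒⟦⟧≡0 {ρ₀} (ρ-valid 0 (+ 0)) (clearedDifferenceₑ n) (initial-identities n 1≤n n≤6)) ⟩
    ⟦ sumₑ (suc (2 ℕ.* n)) (λ i → rhsClearedₑ n (+ i ℤ.- + n)) ⟧ ρ₀  ≡⟨ sym (rhs-cleared n) ⟩
    denominator n * rhs q n                         ∎)

  lhs≡rhs : ∀ n → 1 ≤ n → lhs q n ≡ rhs q n
  lhs≡rhs n 1≤n with n ℕ.<? 3
  ... | yes n<3 = lhs≡rhs-initial n 1≤n (ℕP.≤-trans (ℕP.<⇒≤ n<3) (ℕP.m≤m+n 3 3))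
  ... | no  n≮3 = monic-recurrence-unique 4 3 recCoeff (λ _ → refl) lhs-recurrence (λ m _ → rhs-recurrence m)
    (λ m 3≤m m<7 → lhs≡rhs-initial m (ℕP.≤-trans (s≤s z≤n) 3≤m) (ℕP.≤-pred m<7)) n (ℕP.≮⇒≥ n≮3)

-- The case q = 0

poch[0]≡1 : ∀ b L → poch 0ℚ b L ≡ 1ℚ
poch[0]≡1 b zero    = refl
poch[0]≡1 b (suc L) = trans (cong (_* (1ℚ - 0ℚ * b ^ L)) (poch[0]≡1 b L)) (cong (λ x → 1ℚ * (1ℚ - x)) (*-zeroˡ (b ^ L)))

0^m≡0 : ∀ m → 1 ≤ m → 0ℚ ^ m ≡ 0ℚ
0^m≡0 (suc m) _ = *-zeroˡ (0ℚ ^ m)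

lhsTerm[q=0,j=0] : ∀ k → lhsTerm 0ℚ (suc k) 0 ≡ 1ℚ
lhsTerm[q=0,j=0] k = congₙ 3 (λ a b c → (1ℚ * a * (1ℚ - b) * 1ℚ) / (c * 1ℚ)) (poch[0]≡1 0ℚ k) (0^m≡0 (2 ℕ.* suc k) (s≤s z≤n)) (poch[0]≡1 0ℚ (suc k))

lhsTerm[q=0,j=1] : ∀ k → lhsTerm 0ℚ (3 ℕ.+ k) 1 ≡ - 1ℚ
lhsTerm[q=0,j=1] k = congₙ 3 (λ a b c → (- 1ℚ * a * (1ℚ - b) * 1ℚ) / (c * poch 0ℚ 0ℚ 1)) (poch[0]≡1 0ℚ (suc k)) (0^m≡0 (2 ℕ.* (3 ℕ.+ k)) (s≤s z≤n)) (poch[0]≡1 0ℚ k)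

lhsTerm[q=0]-vanishes : ∀ n j → 2 ≤ j → lhsTerm 0ℚ n j ≡ 0ℚ
lhsTerm[q=0]-vanishes n (suc zero) (s≤s ())
lhsTerm[q=0]-vanishes n (suc (suc i)) _ with 3 ℕ.* suc (suc i) ℕ.≤? n
... | no  _ = refl
... | yes _ = trans (cong (λ e → (A * e) / D) (trans (cong (0ℚ ^_) (3[1+m]²∸3[1+m]≡3[1+m]m (suc i))) (0^m≡0 (3 ℕ.* suc (suc i) ℕ.* suc i) (s≤s z≤n))))
  (solve 2 (λ a d → a :* con 0ℚ :* d := con 0ℚ) refl A (inv D))
  where
  A = sgn (suc (suc i)) * poch (0ℚ ^ 3) (0ℚ ^ 3) (n ℕ.∸ suc (suc i) ℕ.∸ 1) * (1ℚ - 0ℚ ^ (2 ℕ.* n))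
  D = poch 0ℚ 0ℚ (n ℕ.∸ 3 ℕ.* suc (suc i)) * poch (0ℚ ^ 6) (0ℚ ^ 6) (suc (suc i))

lhs[q=0] : ∀ k → lhs 0ℚ (3 ℕ.+ k) ≡ 0ℚ
lhs[q=0] k = begin
  lhs 0ℚ (3 ℕ.+ k)                                        ≡⟨ sumTo-vanishing-tail {2} {4 ℕ.+ k} (lhsTerm 0ℚ (3 ℕ.+ k)) (s≤s (s≤s z≤n)) (lhsTerm[q=0]-vanishes (3 ℕ.+ k)) ⟩
  0ℚ + lhsTerm 0ℚ (3 ℕ.+ k) 0 + lhsTerm 0ℚ (3 ℕ.+ k) 1    ≡⟨ cong₂ (λ a b → 0ℚ + a + b) (lhsTerm[q=0,j=0] (2 ℕ.+ k)) (lhsTerm[q=0,j=1] k) ⟩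
  0ℚ + 1ℚ + - 1ℚ                                          ≡⟨⟩
  0ℚ                                                      ∎

qbinomℤ[q=0] : ∀ a k → qbinomℤ 0ℚ (+ a) (+ k) ≡ 1ℚ
qbinomℤ[q=0] a k = congₙ 3 (λ x y z → x / (y * z)) (poch[0]≡1 0ℚ (a ℕ.+ k)) (poch[0]≡1 0ℚ a) (poch[0]≡1 0ℚ k)

rhsTerm[q=0]-vanishes : ∀ n j m → 3 ℕ.* ℤ.∣ j ℤ.* (j ℤ.+ + 1) ∣ ≡ suc m → rhsTerm 0ℚ n j ≡ 0ℚ
rhsTerm[q=0]-vanishes n j m e≡1+m = trans (cong (λ e → sgn ℤ.∣ j ∣ * 0ℚ ^ e * B) e≡1+m)
  (solve 3 (λ s p b → s :* (con 0ℚ :* p) :* b := con 0ℚ) refl (sgn ℤ.∣ j ∣) (0ℚ ^ m) B)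
  where B = qbinom 0ℚ (2 ℕ.* n) (+ n ℤ.- + 3 ℤ.* j)

rhs[q=0] : ∀ k → rhs 0ℚ (3 ℕ.+ k) ≡ 0ℚ
rhs[q=0] k = begin
  rhs 0ℚ n                                    ≡⟨ window-vanishing (rhsTerm 0ℚ n) {1} {n} (s≤s z≤n) outside ⟩
  0ℚ + rhsTerm 0ℚ n -[1+ 0 ] + rhsTerm 0ℚ n (+ 0) + rhsTerm 0ℚ n (+ 1)
    ≡⟨ congₙ 3 (λ a b c → 0ℚ + a + b + c) (cong (λ x → - 1ℚ * 1ℚ * x) (trans (cong₂ (qbinomℤ 0ℚ) 2n-K[-1]≡k K[-1]≡6+k) (qbinomℤ[q=0] k (6 ℕ.+ k))))
         (cong (λ x → 1ℚ * 1ℚ * x) (trans (cong₂ (qbinomℤ 0ℚ) 2n-K[0]≡n (ℤP.+-identityʳ (+ n))) (qbinomℤ[q=0] n n))) (rhsTerm[q=0]-vanishes n (+ 1) _ refl) ⟩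
  0ℚ + - 1ℚ * 1ℚ * 1ℚ + 1ℚ * 1ℚ * 1ℚ + 0ℚ      ≡⟨⟩
  0ℚ                                          ∎
  where
  n = 3 ℕ.+ k
  outside : ∀ j → 1 < ℤ.∣ j ∣ → rhsTerm 0ℚ n j ≡ 0ℚ
  outside (+ suc m)    _ = rhsTerm[q=0]-vanishes n (+ suc m) _ refl
  outside -[1+ suc m ] _ = rhsTerm[q=0]-vanishes n -[1+ suc m ] _ refl
  outside (+ zero)     ()
  outside -[1+ zero ]  (s≤s ())
  K[-1]≡6+k : + n ℤ.- + 3 ℤ.* -[1+ 0 ] ≡ + (6 ℕ.+ k)
  K[-1]≡6+k = cong +_ (ℕP.+-comm n 3)
  2n-K[-1]≡k : + (2 ℕ.* n) ℤ.- (+ n ℤ.- + 3 ℤ.* -[1+ 0 ]) ≡ + k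
  2n-K[-1]≡k = trans (cong₂ ℤ._-_ (ℤP.pos-* 2 n) K[-1]≡6+k) (cancel (+ k))
    where
    cancel : ∀ k → + 2 ℤ.* (+ 3 ℤ.+ k) ℤ.- (+ 6 ℤ.+ k) ≡ k
    cancel = solve-∀
  2n-K[0]≡n : + (2 ℕ.* n) ℤ.- (+ n ℤ.- + 3 ℤ.* + 0) ≡ + n
  2n-K[0]≡n = trans (cong (ℤ._- (+ n ℤ.- + 0)) (ℤP.pos-* 2 n)) (cancel (+ n))
    where
    cancel : ∀ n → + 2 ℤ.* n ℤ.- (n ℤ.- + 0) ≡ n
    cancel = solve-∀

lhs≡rhs[q=0] : ∀ n → 0 < n → lhs 0ℚ n ≡ rhs 0ℚ n
lhs≡rhs[q=0] 1                   _ = refl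
lhs≡rhs[q=0] 2                   _ = refl
lhs≡rhs[q=0] (suc (suc (suc k))) _ = trans (lhs[q=0] k) (sym (rhs[q=0] k))

theorem1p7 : (q : ℚ) → (∀ (k : ℕ) → 1 ≤ k → q ^ k ≢ 1ℚ) →
    (n : ℕ) → 0 < n → lhs q n ≡ rhs q n
theorem1p7 q q^k≢1 n 0<n with q ≟ 0ℚ
... | yes refl = lhs≡rhs[q=0] n 0<n
... | no  q≢0  = Generic.lhs≡rhs q q≢0 q^k≢1 n 0<n
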